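{- Let $q$ be a parameter and $R(x,q)=\sum_{n\ge0}R_n(q)x^n=\frac{1-qx-\sqrt{(1-qx)^2-4x}}{2x}$. Let $\mathcal{Y}_n$ be the set of $q$-large Schröder paths of length $2n$ whose first step is not an $\mathbf{H}$-step and whose first two steps are not $\mathbf{ud}$. Let $\mathcal{V}_n$ be the set of weighted Dyck paths of length $2n$ described in the context, with weight functions $\alpha(x)=(q+1)x$, $\beta(x)=\frac{R(x,q)-1}{q+1}$ and $\gamma(x)=x(R(x,q)-1)$. Then there exists a (weight-preserving) bijection between $\mathcal{Y}_n$ and $\mathcal{V}_n$.
   Context: A $q$-large Schröder path of length $2n$ is a lattice path from $(0,0)$ to $(2n,0)$ never going below the $x$-axis, with up steps $\mathbf{u}=(1,1)$ and down steps $\mathbf{d}=(1,-1)$ of weight $1$ and horizontal steps $\mathbf{H}=(2,0)$ of weight $q$; its weight is the product of its step weights, and $R_n(q)$ is the total weight of all such paths of length $2n$. A Dyck path of length $2n$ is a lattice path from $(0,0)$ to $(2n,0)$ with steps $\mathbf{u}$, $\mathbf{d}$ never going below the $x$-axis. A valley is an occurrence of $\mathbf{du}$; its level is the ordinate of the common point of its two steps. A pyramid is a consecutive section $\mathbf{u}^h\mathbf{d}^h$ ($h\ge1$ its height); it is maximal if it cannot be extended to $\mathbf{u}^{h+1}\mathbf{d}^{h+1}$; its altitude is the ordinate of the endpoint of its last $\mathbf{d}$-step. A Dyck path is primitive if it is nonempty and touches the $x$-axis only at its endpoints. Given weight functions $\alpha(x)=\sum_{k\ge1}\alpha_kx^k$,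 $\beta(x)=\sum_{k\ge1}\beta_kx^k$, $\gamma(x)=\sum_{k\ge1}\gamma_kx^k$, let $\mathcal{A}_n$ be the set of primitive Dyck paths $P$ of length $2n$ all of whose valleys lie at the same level, weighted by: $w(\mathbf{u}^n\mathbf{d}^n)=\gamma_n$, and for $P=\mathbf{u}^k\mathbf{u}^{i_1}\mathbf{d}^{i_1}\cdots\mathbf{u}^{i_r}\mathbf{d}^{i_r}\mathbf{d}^k$ ($k\ge1$, $r\ge2$, $i_j\ge1$), $w(P)=\beta_k\alpha_{i_1}\cdots\alpha_{i_r}$; only paths of nonzero weight are kept. $\mathcal{V}_n$ is the set of Dyck paths of length $2n$ that are concatenations of zero or more paths from $\bigcup_{s\ge1}\mathcal{A}_s$, weighted by the product of the weights of the factors (empty path: weight $1$). A bijection between sets of weighted paths whose weights are polynomials with nonnegative integer coefficients in the parameters is understood in the weight-preserving sense: each path is regarded as a collection of copies, one per monomial term counted with multiplicity, and the bijection matches these copies with equal monomial weights. -}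

module Defs where

open import Data.Nat using (ℕ; zero; suc; _+_; _*_; _∸_; _≡ᵇ_; _<ᵇ_)
open import Data.Bool using (Bool; true; false; _∧_; not; if_then_else_; T)
open import Data.List using (List; []; _∷_; _++_; map; foldr; length; replicate; reverse)
open import Data.Maybe using (Maybe; just; nothing; maybe)
open import Data.Product using (Σ; _×_; _,_; proj₁; proj₂)
open import Data.Fin using (Fin)

allB : {A : Set} → (A → Bool) → List A → Bool
allB P [] = true
allB P (x ∷ xs) = P x ∧ allB P xs

-- Polynomials in q with natural-number coefficients,
-- as coefficient lists, lowest degree first (trailing zeros allowed).

Poly : Set
Poly = List ℕ

_+ₚ_ : Poly → Poly → Poly
[] +ₚ q = q
(a ∷ p) +ₚ [] = a ∷ p
(a ∷ p) +ₚ (b ∷ q) = (a + b) ∷ (p +ₚ q)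

scaleₚ : ℕ → Poly → Poly
scaleₚ c = map (c *_)

_*ₚ_ : Poly → Poly → Poly
[] *ₚ q = []
(a ∷ p) *ₚ q = scaleₚ a q +ₚ (0 ∷ (p *ₚ q))

0ₚ 1ₚ : Poly
0ₚ = []
1ₚ = 1 ∷ []

qpow : ℕ → Poly
qpow j = replicate j 0 ++ (1 ∷ [])

sumₚ : List Poly → Poly
sumₚ = foldr _+ₚ_ 0ₚ

prodₚ : List Poly → Poly
prodₚ = foldr _*ₚ_ 1ₚ

coeff : Poly → ℕ → ℕ
coeff [] j = 0
coeff (a ∷ p) zero = a
coeff (a ∷ p) (suc j) = coeff p j

isZeroₚ : Poly → Bool
isZeroₚ = allB (λ c → c ≡ᵇ 0)

-- division by (1 + q): quotient b with b_0 = c_0, b_i = c_i - b_{i-1}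
-- (exact whenever (1+q) divides the polynomial with a quotient in ℕ[q]).
divOnePlusQ : Poly → Poly
divOnePlusQ = go 0
  where
  go : ℕ → Poly → Poly
  go prev [] = []
  go prev (c ∷ cs) = (c ∸ prev) ∷ go (c ∸ prev) cs

-- q-large Schröder paths: steps u=(1,1), d=(1,-1), H=(2,0)

data Step : Set where
  U D H : Step

size : List Step → ℕ
size [] = 0
size (U ∷ p) = suc (size p)
size (D ∷ p) = suc (size p)
size (H ∷ p) = suc (suc (size p))

numH : List Step → ℕ
numH [] = 0
numH (H ∷ p) = suc (numH p)
numH (U ∷ p) = numH p
numH (D ∷ p) = numH p

schFrom : ℕ → List Step → Bool
schFrom zero [] = true
schFrom (suc _) [] = false
schFrom h (U ∷ p) = schFrom (suc h) p
schFrom zero (D ∷ p) = false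
schFrom (suc h) (D ∷ p) = schFrom h p
schFrom h (H ∷ p) = schFrom h p

isSchroder : ℕ → List Step → Bool
isSchroder n p = schFrom 0 p ∧ (size p ≡ᵇ (2 * n))

schWeight : List Step → Poly
schWeight p = qpow (numH p)

allSeqs : ℕ → List (List Step)
allSeqs zero = [] ∷ []
allSeqs (suc zero) = (U ∷ []) ∷ (D ∷ []) ∷ []
allSeqs (suc (suc m)) =
  map (U ∷_) (allSeqs (suc m)) ++ (map (D ∷_) (allSeqs (suc m)) ++ map (H ∷_) (allSeqs m))

Rpoly : ℕ → Poly
Rpoly n = sumₚ (map (λ p → if isSchroder n p then schWeight p else 0ₚ) (allSeqs (2 * n)))

goodStart : List Step → Bool
goodStart (H ∷ _) = false
goodStart (U ∷ D ∷ _) = false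
goodStart _ = true

isY : ℕ → List Step → Bool
isY n p = isSchroder n p ∧ goodStart p

-- copies of elements of Y_n: each path has the single monomial q^(#H)
YCopy : ℕ → Set
YCopy n = Σ (List Step) (λ p → T (isY n p))

expY : (n : ℕ) → YCopy n → ℕ
expY n (p , _) = numH p

data DStep : Set where
  u d : DStep

dyckFrom : ℕ → List DStep → Bool
dyckFrom zero [] = true
dyckFrom (suc _) [] = false
dyckFrom h (u ∷ p) = dyckFrom (suc h) p
dyckFrom zero (d ∷ p) = false
dyckFrom (suc h) (d ∷ p) = dyckFrom h p

isDyck : List DStep → Bool
isDyck = dyckFrom 0

-- decomposition of a Dyck path into its primitive factors (returns to the axis);
-- h is the current height, acc the current factor (reversed)
compsGo : ℕ → List DStep → List DStep → List (List DStep)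
compsGo h acc [] = []
compsGo h acc (u ∷ p) = compsGo (suc h) (u ∷ acc) p
compsGo zero acc (d ∷ p) = []
compsGo (suc zero) acc (d ∷ p) = reverse (d ∷ acc) ∷ compsGo zero [] p
compsGo (suc (suc h)) acc (d ∷ p) = compsGo (suc h) (d ∷ acc) p

comps : List DStep → List (List DStep)
comps = compsGo zero []

isPrimitive : List DStep → Bool
isPrimitive p = isDyck p ∧ (length (comps p) ≡ᵇ 1)

valleys : ℕ → List DStep → List ℕ
valleys h [] = []
valleys h (d ∷ rest@(u ∷ p)) = (h ∸ 1) ∷ valleys (h ∸ 1) rest
valleys h (d ∷ p) = valleys (h ∸ 1) p
valleys h (u ∷ p) = valleys (suc h) p

allEqual : List ℕ → Bool
allEqual [] = true
allEqual (x ∷ xs) = allB (λ y → y ≡ᵇ x) xs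

sameStep : DStep → DStep → Bool
sameStep u u = true
sameStep d d = true
sameStep _ _ = false

runs : List DStep → List (DStep × ℕ)
runs [] = []
runs (s ∷ p) with runs p
... | [] = (s , 1) ∷ []
... | (t , k) ∷ rest = if sameStep s t then (t , suc k) ∷ rest else (s , 1) ∷ (t , k) ∷ rest

toPairs : List (DStep × ℕ) → Maybe (List (ℕ × ℕ))
toPairs [] = just []
toPairs ((u , a) ∷ (d , b) ∷ r) with toPairs r
... | just ps = just ((a , b) ∷ ps)
... | nothing = nothing
toPairs _ = nothing

-- The weighted families A_n and V_n for weight functions
-- α(x) = Σ α k x^k, β(x) = Σ β k x^k, γ(x) = Σ γ k x^k (coefficients in ℕ[q]).

module WeightedDyck (α β γ : ℕ → Poly) where

  tailOK : List (ℕ × ℕ) → ℕ → Bool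
  tailOK [] k = false
  tailOK ((a , b) ∷ []) k = b ≡ᵇ (a + k)
  tailOK ((a , b) ∷ r@(_ ∷ _)) k = (a ≡ᵇ b) ∧ tailOK r k

  -- weight of a path given by its runs:
  --   u^n d^n                                     ↦ γ_n
  --   u^k u^{i1} d^{i1} ... u^{ir} d^{ir} d^k     ↦ β_k α_{i1} ... α_{ir}  (k ≥ 1, r ≥ 2)
  formWeight : List (ℕ × ℕ) → Poly
  formWeight [] = 0ₚ
  formWeight ((a , b) ∷ []) = if a ≡ᵇ b then γ a else 0ₚ
  formWeight ((a , b) ∷ rest@(_ ∷ _)) =
    if (b <ᵇ a) ∧ tailOK rest (a ∸ b)
    then β (a ∸ b) *ₚ (α b *ₚ prodₚ (map (λ ab → α (proj₁ ab)) rest))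
    else 0ₚ

  -- weight of a primitive Dyck path all of whose valleys are at the same level
  -- (0 for any other path)
  wA : List DStep → Poly
  wA p = if isPrimitive p ∧ allEqual (valleys 0 p)
         then maybe formWeight 0ₚ (toPairs (runs p))
         else 0ₚ

  -- membership in ⋃_s A_s (only paths of nonzero weight are kept)
  inA : List DStep → Bool
  inA p = not (isZeroₚ (wA p))

  isV : ℕ → List DStep → Bool
  isV n p = isDyck p ∧ ((length p ≡ᵇ (2 * n)) ∧ allB inA (comps p))

  wV : List DStep → Poly
  wV p = prodₚ (map wA (comps p))

  -- copies of elements of V_n: one copy per monomial q^j, with multiplicity
  VCopyG : ℕ → Set
  VCopyG n = Σ (List DStep) (λ p → T (isV n p) × Σ ℕ (λ j → Fin (coeff (wV p) j)))

  expVG : (n : ℕ) → VCopyG n → ℕ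
  expVG n (p , _ , j , _) = j

αS : ℕ → Poly
αS (suc zero) = 1 ∷ 1 ∷ []
αS _ = 0ₚ

βS : ℕ → Poly
βS zero = 0ₚ
βS (suc k) = divOnePlusQ (Rpoly (suc k))

-- γ(x) = x (R(x,q) - 1):  γ_1 = R_0 - 1 = 0, γ_{m+2} = R_{m+1}
γS : ℕ → Poly
γS zero = 0ₚ
γS (suc zero) = 0ₚ
γS (suc (suc m)) = Rpoly (suc m)

VCopy : ℕ → Set
VCopy = WeightedDyck.VCopyG αS βS γS

expV : (n : ℕ) → VCopy n → ℕ
expV = WeightedDyck.expVG αS βS γS

-- Both sides are sequences of one class 𝔽 = x (R − 1) + S α² / (1 − α), where α = (q + 1) x and S counts the
-- nonempty small Schröder paths (no H on the axis). R − 1 = (1 + q) S, since turning the first H on the axis,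
-- with everything after it, into a new first arch maps the nonempty paths with an H on the axis bijectively onto
-- the nonempty small paths and removes one factor q.
-- A V-path is the concatenation of its primitive factors; as α has only a linear term, the factors of nonzero weight
-- are the pyramids u^(m+2) d^(m+2) of weight R_(m+1), giving x (R − 1), and the plateaus u^k (u d)^(r+2) d^k of
-- weight β_k α_1^(r+2), giving S α² / (1 − α). A nonempty Y-path is U P D P′ with P nonempty, and P′ is a run of
-- steps H and U D followed by a Y-path, so Y = 1 + x (R − 1) / (1 − α) · Y, and x (R − 1) / (1 − α) = 𝔽.
-- All these identities are weight-preserving bijections of classes; their fibres of x-degree n give the theorem.

module Submission where

open import Axiom.UniquenessOfIdentityProofs.WithK using (uip)
open import Data.Bool using (Bool; true; false; T; if_then_else_; _∧_; not)
import Data.Bool.Properties as Boolₚ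
open import Data.Empty using (⊥; ⊥-elim)
open import Data.Fin using (Fin)
import Data.Fin.Properties as Finₚ
open import Data.List using (List; []; _∷_; _++_; map; concat; length; replicate; reverse; [_]; drop)
import Data.List.Properties as Listₚ
open import Data.List.Relation.Unary.All using (All; []; _∷_)
open import Data.Maybe using (just; nothing; maybe)
open import Data.Maybe.Properties using (just-injective)
open import Data.Nat using (ℕ; zero; suc; pred; _+_; _*_; _∸_; _≤_; _<_; z≤n; s≤s; _≡ᵇ_; _<ᵇ_)
open import Data.Nat.Induction using (<-wellFounded)
open import Data.Nat.ListAction using (sum)
import Data.Nat.Properties as ℕₚ
open import Data.Nat.Tactic.RingSolver using (solve-∀)
open import Data.Product using (Σ; ∃; _×_; _,_; proj₁; proj₂)
open import Data.Product.Properties using (,-injective)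
open import Data.Sum using (_⊎_; inj₁; inj₂)
open import Data.Sum.Properties using (inj₁-injective; inj₂-injective)
open import Data.Unit using (⊤; tt)
open import Function.Bundles using (_↔_; Inverse; mk↔ₛ′; Equivalence; _⤖_; Bijection; mk⤖)
open import Induction.WellFounded using (Acc; acc)
open import Relation.Binary.PropositionalEquality using (_≡_; refl; sym; trans; cong; cong₂; subst; module ≡-Reasoning)
open import Defs

open WeightedDyck αS βS γS

∧-split : ∀ {a b} → T (a ∧ b) → T a × T b
∧-split = Equivalence.to Boolₚ.T-∧

∧-intro : ∀ {a b} → T a → T b → T (a ∧ b)
∧-intro x y = Equivalence.from Boolₚ.T-∧ (x , y)

-- Combinatorial classes

-- An object o of a class stands for the monomial x ^ xdeg o * q ^ qdeg o.
record Class : Set₁ where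
  constructor mkClass
  field
    Obj  : Set
    xdeg : Obj → ℕ
    qdeg : Obj → ℕ

open Class public

record _≅_ (A B : Class) : Set where
  field
    to      : Obj A → Obj B
    from    : Obj B → Obj A
    from-to : ∀ a → from (to a) ≡ a
    to-from : ∀ b → to (from b) ≡ b
    xdeg-to : ∀ a → xdeg B (to a) ≡ xdeg A a
    qdeg-to : ∀ a → qdeg B (to a) ≡ qdeg A a

open _≅_ public

infix  3 _≅_

infixr 4 _⟫_

infixr 6 _⊕_

infixr 7 _⊗_

≅-refl : ∀ {A} → A ≅ A
≅-refl = record
  { to = λ a → a ; from = λ a → a ; from-to = λ _ → refl ; to-from = λ _ → refl
  ; xdeg-to = λ _ → refl ; qdeg-to = λ _ → refl }

≅-sym : ∀ {A B} → A ≅ B → B ≅ A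
≅-sym {A} {B} e = record
  { to = from e ; from = to e ; from-to = to-from e ; to-from = from-to e
  ; xdeg-to = λ b → trans (sym (xdeg-to e (from e b))) (cong (xdeg B) (to-from e b))
  ; qdeg-to = λ b → trans (sym (qdeg-to e (from e b))) (cong (qdeg B) (to-from e b)) }

_⟫_ : ∀ {A B C} → A ≅ B → B ≅ C → A ≅ C
e ⟫ f = record
  { to = λ a → to f (to e a) ; from = λ c → from e (from f c)
  ; from-to = λ a → trans (cong (from e) (from-to f (to e a))) (from-to e a)
  ; to-from = λ c → trans (cong (to f) (to-from e (from f c))) (to-from f c)
  ; xdeg-to = λ a → trans (xdeg-to f (to e a)) (xdeg-to e a)
  ; qdeg-to = λ a → trans (qdeg-to f (to e a)) (qdeg-to e a) }

module ≅-Reasoning where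

  infix  1 begin_
  infixr 2 _≅⟨_⟩_
  infix  3 _∎

  begin_ : ∀ {A B} → A ≅ B → A ≅ B
  begin e = e

  _≅⟨_⟩_ : ∀ A {B C} → A ≅ B → B ≅ C → A ≅ C
  _ ≅⟨ e ⟩ f = e ⟫ f

  _∎ : ∀ A → A ≅ A
  _ ∎ = ≅-refl

≡⇒≅ : ∀ {A B} → A ≡ B → A ≅ B
≡⇒≅ refl = ≅-refl

≅-from-injective : ∀ {A B} (e : A ≅ B) {b b′} → from e b ≡ from e b′ → b ≡ b′
≅-from-injective e {b} {b′} p = trans (sym (to-from e b)) (trans (cong (to e) p) (to-from e b′))

≅-to-injective : ∀ {A B} (e : A ≅ B) {a a′} → to e a ≡ to e a′ → a ≡ a′
≅-to-injective e = ≅-from-injective (≅-sym e)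

𝟘 𝟙 𝕩 𝕢 𝕩𝕢 : Class
𝟘  = mkClass ⊥ (λ ()) (λ ())
𝟙  = mkClass ⊤ (λ _ → 0) (λ _ → 0)
𝕩  = mkClass ⊤ (λ _ → 1) (λ _ → 0)
𝕢  = mkClass ⊤ (λ _ → 0) (λ _ → 1)
𝕩𝕢 = mkClass ⊤ (λ _ → 1) (λ _ → 1)

_⊕_ : Class → Class → Class
A ⊕ B = mkClass (Obj A ⊎ Obj B)
  (λ { (inj₁ a) → xdeg A a ; (inj₂ b) → xdeg B b })
  (λ { (inj₁ a) → qdeg A a ; (inj₂ b) → qdeg B b })

_⊗_ : Class → Class → Class
A ⊗ B = mkClass (Obj A × Obj B)
  (λ (a , b) → xdeg A a + xdeg B b)
  (λ (a , b) → qdeg A a + qdeg B b)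

Σᶜ : (I : Set) → (I → Class) → Class
Σᶜ I F = mkClass (Σ I (λ i → Obj (F i))) (λ (i , o) → xdeg (F i) o) (λ (i , o) → qdeg (F i) o)

Seq : Class → Class
Seq A = mkClass (List (Obj A)) (λ os → sum (map (xdeg A) os)) (λ os → sum (map (qdeg A) os))

-- the coefficient of x ^ n, as a class of q-weighted objects
Fibre : Class → ℕ → Class
Fibre A n = mkClass (Σ (Obj A) (λ a → xdeg A a ≡ n)) (λ _ → 0) (λ (a , _) → qdeg A a)

Sub : (A : Class) → (Obj A → Bool) → Class
Sub A P = mkClass (Σ (Obj A) (λ a → T (P a))) (λ (a , _) → xdeg A a) (λ (a , _) → qdeg A a)

atX : ℕ → Class → Class
atX n B = mkClass (Obj B) (λ _ → n) (qdeg B)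

graded : (X : ℕ → Set) → (∀ n → X n → ℕ) → Class
graded X e = Σᶜ ℕ (λ n → mkClass (X n) (λ _ → n) (e n))

Positive : Class → Set
Positive A = ∀ a → 0 < xdeg A a

⊕-cong : ∀ {A B A′ B′} → A ≅ A′ → B ≅ B′ → A ⊕ B ≅ A′ ⊕ B′
⊕-cong e f = record
  { to      = λ { (inj₁ a) → inj₁ (to e a) ; (inj₂ b) → inj₂ (to f b) }
  ; from    = λ { (inj₁ a) → inj₁ (from e a) ; (inj₂ b) → inj₂ (from f b) }
  ; from-to = λ { (inj₁ a) → cong inj₁ (from-to e a) ; (inj₂ b) → cong inj₂ (from-to f b) }
  ; to-from = λ { (inj₁ a) → cong inj₁ (to-from e a) ; (inj₂ b) → cong inj₂ (to-from f b) }
  ; xdeg-to = λ { (inj₁ a) → xdeg-to e a ; (inj₂ b) → xdeg-to f b }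
  ; qdeg-to = λ { (inj₁ a) → qdeg-to e a ; (inj₂ b) → qdeg-to f b } }

⊗-cong : ∀ {A B A′ B′} → A ≅ A′ → B ≅ B′ → A ⊗ B ≅ A′ ⊗ B′
⊗-cong e f = record
  { to      = λ (a , b) → to e a , to f b
  ; from    = λ (a , b) → from e a , from f b
  ; from-to = λ (a , b) → cong₂ _,_ (from-to e a) (from-to f b)
  ; to-from = λ (a , b) → cong₂ _,_ (to-from e a) (to-from f b)
  ; xdeg-to = λ (a , b) → cong₂ _+_ (xdeg-to e a) (xdeg-to f b)
  ; qdeg-to = λ (a , b) → cong₂ _+_ (qdeg-to e a) (qdeg-to f b) }

⊗-congˡ : ∀ {A B B′} → B ≅ B′ → A ⊗ B ≅ A ⊗ B′
⊗-congˡ = ⊗-cong ≅-refl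

⊗-congʳ : ∀ {A A′ B} → A ≅ A′ → A ⊗ B ≅ A′ ⊗ B
⊗-congʳ e = ⊗-cong e ≅-refl

Σᶜ-cong : ∀ {I} {F G : I → Class} → (∀ i → F i ≅ G i) → Σᶜ I F ≅ Σᶜ I G
Σᶜ-cong e = record
  { to      = λ (i , o) → i , to (e i) o
  ; from    = λ (i , o) → i , from (e i) o
  ; from-to = λ (i , o) → cong (i ,_) (from-to (e i) o)
  ; to-from = λ (i , o) → cong (i ,_) (to-from (e i) o)
  ; xdeg-to = λ (i , o) → xdeg-to (e i) o
  ; qdeg-to = λ (i , o) → qdeg-to (e i) o }

Seq-cong : ∀ {A B} → A ≅ B → Seq A ≅ Seq B
Seq-cong {A} {B} e = record
  { to      = map (to e)
  ; from    = map (from e)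
  ; from-to = λ os → trans (sym (Listₚ.map-∘ os)) (trans (Listₚ.map-cong (from-to e) os) (Listₚ.map-id os))
  ; to-from = λ os → trans (sym (Listₚ.map-∘ os)) (trans (Listₚ.map-cong (to-from e) os) (Listₚ.map-id os))
  ; xdeg-to = λ os → cong sum (trans (sym (Listₚ.map-∘ os)) (Listₚ.map-cong (xdeg-to e) os))
  ; qdeg-to = λ os → cong sum (trans (sym (Listₚ.map-∘ os)) (Listₚ.map-cong (qdeg-to e) os)) }

Fibre-cong : ∀ {A B} n → A ≅ B → Fibre A n ≅ Fibre B n
Fibre-cong {A} {B} n e = record
  { to      = λ (a , p) → to e a , trans (xdeg-to e a) p
  ; from    = λ (b , p) → from e b , trans (xdeg-to (≅-sym e) b) p
  ; from-to = λ (a , _) → Σ-≡ (from-to e a)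
  ; to-from = λ (b , _) → Σ-≡ (to-from e b)
  ; xdeg-to = λ _ → refl
  ; qdeg-to = λ (a , _) → qdeg-to e a }
  where
  Σ-≡ : ∀ {C : Set} {f : C → ℕ} {c c′} {p : f c ≡ n} {p′ : f c′ ≡ n} → c ≡ c′ → (c , p) ≡ (c′ , p′)
  Σ-≡ refl = cong (_ ,_) (uip _ _)

Sub-cong : ∀ {A B} (e : A ≅ B) (P : Obj A → Bool) (Q : Obj B → Bool) →
           (∀ a → P a ≡ Q (to e a)) → Sub A P ≅ Sub B Q
Sub-cong e P Q P≡Q = record
  { to      = λ (a , p) → to e a , subst T (P≡Q a) p
  ; from    = λ (b , p) → from e b , subst T (sym (trans (P≡Q (from e b)) (cong Q (to-from e b)))) p
  ; from-to = λ (a , _) → Σ-≡ (from-to e a)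
  ; to-from = λ (b , _) → Σ-≡ (to-from e b)
  ; xdeg-to = λ (a , _) → xdeg-to e a
  ; qdeg-to = λ (a , _) → qdeg-to e a }
  where
  Σ-≡ : ∀ {C : Set} {R : C → Bool} {c c′} {p : T (R c)} {p′ : T (R c′)} → c ≡ c′ → (c , p) ≡ (c′ , p′)
  Σ-≡ refl = cong (_ ,_) (Boolₚ.T-irrelevant _ _)

atX-cong : ∀ {A B} n → A ≅ B → atX n A ≅ atX n B
atX-cong n e = record
  { to = to e ; from = from e ; from-to = from-to e ; to-from = to-from e
  ; xdeg-to = λ _ → refl ; qdeg-to = qdeg-to e }

⊕-comm : ∀ {A B} → A ⊕ B ≅ B ⊕ A
⊕-comm = record
  { to      = λ { (inj₁ a) → inj₂ a ; (inj₂ b) → inj₁ b }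
  ; from    = λ { (inj₁ b) → inj₂ b ; (inj₂ a) → inj₁ a }
  ; from-to = λ { (inj₁ _) → refl ; (inj₂ _) → refl }
  ; to-from = λ { (inj₁ _) → refl ; (inj₂ _) → refl }
  ; xdeg-to = λ { (inj₁ _) → refl ; (inj₂ _) → refl }
  ; qdeg-to = λ { (inj₁ _) → refl ; (inj₂ _) → refl } }

⊕-assoc : ∀ {A B C} → (A ⊕ B) ⊕ C ≅ A ⊕ (B ⊕ C)
⊕-assoc = record
  { to      = λ { (inj₁ (inj₁ a)) → inj₁ a ; (inj₁ (inj₂ b)) → inj₂ (inj₁ b) ; (inj₂ c) → inj₂ (inj₂ c) }
  ; from    = λ { (inj₁ a) → inj₁ (inj₁ a) ; (inj₂ (inj₁ b)) → inj₁ (inj₂ b) ; (inj₂ (inj₂ c)) → inj₂ c }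
  ; from-to = λ { (inj₁ (inj₁ _)) → refl ; (inj₁ (inj₂ _)) → refl ; (inj₂ _) → refl }
  ; to-from = λ { (inj₁ _) → refl ; (inj₂ (inj₁ _)) → refl ; (inj₂ (inj₂ _)) → refl }
  ; xdeg-to = λ { (inj₁ (inj₁ _)) → refl ; (inj₁ (inj₂ _)) → refl ; (inj₂ _) → refl }
  ; qdeg-to = λ { (inj₁ (inj₁ _)) → refl ; (inj₁ (inj₂ _)) → refl ; (inj₂ _) → refl } }

⊗-comm : ∀ {A B} → A ⊗ B ≅ B ⊗ A
⊗-comm {A} {B} = record
  { to      = λ (a , b) → b , a
  ; from    = λ (b , a) → a , b
  ; from-to = λ _ → refl
  ; to-from = λ _ → refl
  ; xdeg-to = λ (a , b) → ℕₚ.+-comm (xdeg B b) (xdeg A a)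
  ; qdeg-to = λ (a , b) → ℕₚ.+-comm (qdeg B b) (qdeg A a) }

⊗-assoc : ∀ {A B C} → (A ⊗ B) ⊗ C ≅ A ⊗ (B ⊗ C)
⊗-assoc {A} {B} {C} = record
  { to      = λ ((a , b) , c) → a , (b , c)
  ; from    = λ (a , (b , c)) → (a , b) , c
  ; from-to = λ _ → refl
  ; to-from = λ _ → refl
  ; xdeg-to = λ ((a , b) , c) → sym (ℕₚ.+-assoc (xdeg A a) (xdeg B b) (xdeg C c))
  ; qdeg-to = λ ((a , b) , c) → sym (ℕₚ.+-assoc (qdeg A a) (qdeg B b) (qdeg C c)) }

⊗-distribˡ-⊕ : ∀ {A B C} → A ⊗ (B ⊕ C) ≅ A ⊗ B ⊕ A ⊗ C
⊗-distribˡ-⊕ = record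
  { to      = λ { (a , inj₁ b) → inj₁ (a , b) ; (a , inj₂ c) → inj₂ (a , c) }
  ; from    = λ { (inj₁ (a , b)) → a , inj₁ b ; (inj₂ (a , c)) → a , inj₂ c }
  ; from-to = λ { (_ , inj₁ _) → refl ; (_ , inj₂ _) → refl }
  ; to-from = λ { (inj₁ _) → refl ; (inj₂ _) → refl }
  ; xdeg-to = λ { (_ , inj₁ _) → refl ; (_ , inj₂ _) → refl }
  ; qdeg-to = λ { (_ , inj₁ _) → refl ; (_ , inj₂ _) → refl } }

⊗-distribʳ-⊕ : ∀ {A B C} → (B ⊕ C) ⊗ A ≅ B ⊗ A ⊕ C ⊗ A
⊗-distribʳ-⊕ = record
  { to      = λ { (inj₁ b , a) → inj₁ (b , a) ; (inj₂ c , a) → inj₂ (c , a) }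
  ; from    = λ { (inj₁ (b , a)) → inj₁ b , a ; (inj₂ (c , a)) → inj₂ c , a }
  ; from-to = λ { (inj₁ _ , _) → refl ; (inj₂ _ , _) → refl }
  ; to-from = λ { (inj₁ _) → refl ; (inj₂ _) → refl }
  ; xdeg-to = λ { (inj₁ _ , _) → refl ; (inj₂ _ , _) → refl }
  ; qdeg-to = λ { (inj₁ _ , _) → refl ; (inj₂ _ , _) → refl } }

⊗-identityˡ : ∀ {A} → 𝟙 ⊗ A ≅ A
⊗-identityˡ = record
  { to = proj₂ ; from = tt ,_ ; from-to = λ _ → refl ; to-from = λ _ → refl
  ; xdeg-to = λ _ → refl ; qdeg-to = λ _ → refl }

⊗-identityʳ : ∀ {A} → A ⊗ 𝟙 ≅ A
⊗-identityʳ {A} = ⊗-comm {A} {𝟙} ⟫ ⊗-identityˡ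

⊕-identityˡ : ∀ {A} → 𝟘 ⊕ A ≅ A
⊕-identityˡ = record
  { to = λ { (inj₂ a) → a } ; from = inj₂
  ; from-to = λ { (inj₂ _) → refl } ; to-from = λ _ → refl
  ; xdeg-to = λ { (inj₂ _) → refl } ; qdeg-to = λ { (inj₂ _) → refl } }

⊕-identityʳ : ∀ {A} → A ⊕ 𝟘 ≅ A
⊕-identityʳ {A} = ⊕-comm {A} {𝟘} ⟫ ⊕-identityˡ

⊗-zeroˡ : ∀ {A} → 𝟘 ⊗ A ≅ 𝟘
⊗-zeroˡ = record
  { to = λ () ; from = λ () ; from-to = λ () ; to-from = λ ()
  ; xdeg-to = λ () ; qdeg-to = λ () }

⊗-zeroʳ : ∀ {A} → A ⊗ 𝟘 ≅ 𝟘
⊗-zeroʳ {A} = ⊗-comm {A} {𝟘} ⟫ ⊗-zeroˡ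

⊗-unfoldˡ-𝟙⊕ : ∀ {A B} → A ⊗ (𝟙 ⊕ B) ≅ A ⊕ A ⊗ B
⊗-unfoldˡ-𝟙⊕ {A} {B} = ⊗-distribˡ-⊕ ⟫ ⊕-cong (⊗-identityʳ {A}) (≅-refl {A ⊗ B})

Seq-unfold : ∀ {A} → Seq A ≅ 𝟙 ⊕ A ⊗ Seq A
Seq-unfold = record
  { to      = λ { [] → inj₁ tt ; (o ∷ os) → inj₂ (o , os) }
  ; from    = λ { (inj₁ _) → [] ; (inj₂ (o , os)) → o ∷ os }
  ; from-to = λ { [] → refl ; (_ ∷ _) → refl }
  ; to-from = λ { (inj₁ _) → refl ; (inj₂ _) → refl }
  ; xdeg-to = λ { [] → refl ; (_ ∷ _) → refl }
  ; qdeg-to = λ { [] → refl ; (_ ∷ _) → refl } }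

Seq-⊕-split : ∀ {A B} → Seq (A ⊕ B) ≅ Seq B ⊕ Seq B ⊗ A ⊗ Seq (A ⊕ B)
Seq-⊕-split {A} {B} = record
  { to = cut ; from = glue ; from-to = glue-cut ; to-from = cut-glue ; xdeg-to = xdeg-cut ; qdeg-to = qdeg-cut }
  where
  Cut : Class
  Cut = Seq B ⊕ Seq B ⊗ A ⊗ Seq (A ⊕ B)

  consB : Obj B → Obj Cut → Obj Cut
  consB b (inj₁ bs)            = inj₁ (b ∷ bs)
  consB b (inj₂ (bs , a , os)) = inj₂ (b ∷ bs , a , os)

  cut : Obj (Seq (A ⊕ B)) → Obj Cut
  cut []            = inj₁ []
  cut (inj₁ a ∷ os) = inj₂ ([] , a , os)
  cut (inj₂ b ∷ os) = consB b (cut os)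

  glue : Obj Cut → Obj (Seq (A ⊕ B))
  glue (inj₁ bs)            = map inj₂ bs
  glue (inj₂ (bs , a , os)) = map inj₂ bs ++ inj₁ a ∷ os

  glue-consB : ∀ b c → glue (consB b c) ≡ inj₂ b ∷ glue c
  glue-consB b (inj₁ _) = refl
  glue-consB b (inj₂ _) = refl

  glue-cut : ∀ os → glue (cut os) ≡ os
  glue-cut []            = refl
  glue-cut (inj₁ a ∷ os) = refl
  glue-cut (inj₂ b ∷ os) = trans (glue-consB b (cut os)) (cong (inj₂ b ∷_) (glue-cut os))

  cut-glue : ∀ c → cut (glue c) ≡ c
  cut-glue (inj₁ [])                = refl
  cut-glue (inj₁ (b ∷ bs))          = cong (consB b) (cut-glue (inj₁ bs))
  cut-glue (inj₂ ([] , a , os))     = refl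
  cut-glue (inj₂ (b ∷ bs , a , os)) = cong (consB b) (cut-glue (inj₂ (bs , a , os)))

  xdeg-consB : ∀ b c → xdeg Cut (consB b c) ≡ xdeg B b + xdeg Cut c
  xdeg-consB b (inj₁ _) = refl
  xdeg-consB b (inj₂ _) = ℕₚ.+-assoc (xdeg B b) _ _

  qdeg-consB : ∀ b c → qdeg Cut (consB b c) ≡ qdeg B b + qdeg Cut c
  qdeg-consB b (inj₁ _) = refl
  qdeg-consB b (inj₂ _) = ℕₚ.+-assoc (qdeg B b) _ _

  xdeg-cut : ∀ os → xdeg Cut (cut os) ≡ xdeg (Seq (A ⊕ B)) os
  xdeg-cut []            = refl
  xdeg-cut (inj₁ a ∷ os) = refl
  xdeg-cut (inj₂ b ∷ os) = trans (xdeg-consB b (cut os)) (cong (xdeg B b +_) (xdeg-cut os))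

  qdeg-cut : ∀ os → qdeg Cut (cut os) ≡ qdeg (Seq (A ⊕ B)) os
  qdeg-cut []            = refl
  qdeg-cut (inj₁ a ∷ os) = refl
  qdeg-cut (inj₂ b ∷ os) = trans (qdeg-consB b (cut os)) (cong (qdeg B b +_) (qdeg-cut os))

Σᶜ-⊤ : ∀ {F : ⊤ → Class} → Σᶜ ⊤ F ≅ F tt
Σᶜ-⊤ = record
  { to = proj₂ ; from = tt ,_ ; from-to = λ _ → refl ; to-from = λ _ → refl
  ; xdeg-to = λ _ → refl ; qdeg-to = λ _ → refl }

Σᶜ-⊎ : ∀ {I J} (F : I ⊎ J → Class) →
       Σᶜ (I ⊎ J) F ≅ Σᶜ I (λ i → F (inj₁ i)) ⊕ Σᶜ J (λ j → F (inj₂ j))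
Σᶜ-⊎ F = record
  { to      = λ { (inj₁ i , o) → inj₁ (i , o) ; (inj₂ j , o) → inj₂ (j , o) }
  ; from    = λ { (inj₁ (i , o)) → inj₁ i , o ; (inj₂ (j , o)) → inj₂ j , o }
  ; from-to = λ { (inj₁ _ , _) → refl ; (inj₂ _ , _) → refl }
  ; to-from = λ { (inj₁ _) → refl ; (inj₂ _) → refl }
  ; xdeg-to = λ { (inj₁ _ , _) → refl ; (inj₂ _ , _) → refl }
  ; qdeg-to = λ { (inj₁ _ , _) → refl ; (inj₂ _ , _) → refl } }

Σᶜ-⊕ : ∀ {I} {F G : I → Class} → Σᶜ I (λ i → F i ⊕ G i) ≅ Σᶜ I F ⊕ Σᶜ I G
Σᶜ-⊕ = record
  { to      = λ { (i , inj₁ a) → inj₁ (i , a) ; (i , inj₂ b) → inj₂ (i , b) }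
  ; from    = λ { (inj₁ (i , a)) → i , inj₁ a ; (inj₂ (i , b)) → i , inj₂ b }
  ; from-to = λ { (_ , inj₁ _) → refl ; (_ , inj₂ _) → refl }
  ; to-from = λ { (inj₁ _) → refl ; (inj₂ _) → refl }
  ; xdeg-to = λ { (_ , inj₁ _) → refl ; (_ , inj₂ _) → refl }
  ; qdeg-to = λ { (_ , inj₁ _) → refl ; (_ , inj₂ _) → refl } }

Σᶜ-⊗ˡ : ∀ {I A} {F : I → Class} → Σᶜ I (λ i → A ⊗ F i) ≅ A ⊗ Σᶜ I F
Σᶜ-⊗ˡ = record
  { to = λ (i , a , o) → a , i , o ; from = λ (a , i , o) → i , a , o
  ; from-to = λ _ → refl ; to-from = λ _ → refl ; xdeg-to = λ _ → refl ; qdeg-to = λ _ → refl }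

module _ {I J : Set} {F : J → Class} (e : I ↔ J) where

  private
    g = Inverse.to e
    h = Inverse.from e

    reindexed : ∀ {j j′} (p : j′ ≡ j) {o : Obj (F j)} →
                _≡_ {A = Σ J (λ j → Obj (F j))} (j′ , subst (λ k → Obj (F k)) (sym p) o) (j , o)
    reindexed refl = refl

    -- with K the two inverse laws are automatically coherent
    reindexedᵍ : ∀ {i i′} (p : i′ ≡ i) (q : g i′ ≡ g i) {o : Obj (F (g i))} →
                 _≡_ {A = Σ I (λ i → Obj (F (g i)))} (i′ , subst (λ k → Obj (F k)) (sym q) o) (i , o)
    reindexedᵍ refl q rewrite uip q refl = refl

    degree-subst : ∀ (deg : ∀ {j} → Obj (F j) → ℕ) {j j′} (p : j′ ≡ j) {o : Obj (F j)} →
                   deg (subst (λ k → Obj (F k)) (sym p) o) ≡ deg o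
    degree-subst deg refl = refl

  Σᶜ-reindex : Σᶜ J F ≅ Σᶜ I (λ i → F (g i))
  Σᶜ-reindex = record
    { to      = λ (j , o) → h j , subst (λ k → Obj (F k)) (sym (Inverse.strictlyInverseˡ e j)) o
    ; from    = λ (i , o) → g i , o
    ; from-to = λ (j , o) → reindexed (Inverse.strictlyInverseˡ e j)
    ; to-from = λ (i , o) → reindexedᵍ (Inverse.strictlyInverseʳ e i) (Inverse.strictlyInverseˡ e (g i))
    ; xdeg-to = λ (j , o) → degree-subst (λ {j} → xdeg (F j)) (Inverse.strictlyInverseˡ e j)
    ; qdeg-to = λ (j , o) → degree-subst (λ {j} → qdeg (F j)) (Inverse.strictlyInverseˡ e j) }

Σᶜ-support : ∀ {I X : Set} (g : I → X) → (∀ {i i′} → g i ≡ g i′ → i ≡ i′) → (F : X → Class) →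
             (∀ x → Obj (F x) → ∃ λ i → g i ≡ x) → Σᶜ I (λ i → F (g i)) ≅ Σᶜ X F
Σᶜ-support {I} {X} g g-injective F cover = record
  { to      = λ (i , o) → g i , o
  ; from    = λ (x , o) → let (i , e) = cover x o in i , subst (λ x → Obj (F x)) (sym e) o
  ; from-to = λ (i , o) → let (i′ , e) = cover (g i) o in back (g-injective e) e
  ; to-from = λ (x , o) → forth (proj₂ (cover x o))
  ; xdeg-to = λ _ → refl
  ; qdeg-to = λ _ → refl }
  where
  forth : ∀ {i x} (e : g i ≡ x) {o} → _≡_ {A = Σ X (λ x → Obj (F x))} (g i , subst (λ x → Obj (F x)) (sym e) o) (x , o)
  forth refl = refl
  back : ∀ {i i′} → i′ ≡ i → ∀ (e : g i′ ≡ g i) {o} →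
         _≡_ {A = Σ I (λ i → Obj (F (g i)))} (i′ , subst (λ x → Obj (F x)) (sym e) o) (i , o)
  back refl e rewrite uip e refl = refl

Fibre-𝟙⊕ : ∀ {A} k → Fibre (𝟙 ⊕ A) (suc k) ≅ Fibre A (suc k)
Fibre-𝟙⊕ k = record
  { to      = λ { (inj₂ a , p) → a , p }
  ; from    = λ (a , p) → inj₂ a , p
  ; from-to = λ { (inj₂ _ , _) → refl }
  ; to-from = λ _ → refl
  ; xdeg-to = λ { (inj₂ _ , _) → refl }
  ; qdeg-to = λ { (inj₂ _ , _) → refl } }

Sub-true : ∀ {A} → Sub A (λ _ → true) ≅ A
Sub-true = record
  { to = proj₁ ; from = _, tt ; from-to = λ _ → refl ; to-from = λ _ → refl
  ; xdeg-to = λ _ → refl ; qdeg-to = λ _ → refl }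

Fibre-graded : ∀ X e n → Fibre (graded X e) n ≅ mkClass (X n) (λ _ → 0) (e n)
Fibre-graded X e n = record
  { to      = λ { ((_ , x) , refl) → x }
  ; from    = λ x → (n , x) , refl
  ; from-to = λ { ((_ , _) , refl) → refl }
  ; to-from = λ _ → refl
  ; xdeg-to = λ { ((_ , _) , refl) → refl }
  ; qdeg-to = λ { ((_ , _) , refl) → refl } }

toBijection : ∀ {X Y : Set} {e : X → ℕ} {e′ : Y → ℕ} → mkClass X (λ _ → 0) e ≅ mkClass Y (λ _ → 0) e′ →
              Σ (X ⤖ Y) (λ b → ∀ x → e x ≡ e′ (Bijection.to b x))
toBijection i = mk⤖ {to = to i} (≅-to-injective i , λ y → from i y , λ { refl → to-from i y }) , λ x → sym (qdeg-to i x)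

Σᶜ-Fibre : ∀ A → Σᶜ ℕ (λ n → atX n (Fibre A n)) ≅ A
Σᶜ-Fibre A = record
  { to      = λ (_ , a , _) → a
  ; from    = λ a → xdeg A a , a , refl
  ; from-to = λ { (_ , _ , refl) → refl }
  ; to-from = λ _ → refl
  ; xdeg-to = λ (_ , _ , p) → p
  ; qdeg-to = λ _ → refl }

Σᶜ-Fibre⁺ : ∀ A → Positive A → Σᶜ ℕ (λ n → atX (suc n) (Fibre A (suc n))) ≅ A
Σᶜ-Fibre⁺ A A⁺ = record
  { to      = λ (_ , a , _) → a
  ; from    = λ a → let (n , p) = predecessor (A⁺ a) in n , a , p
  ; from-to = λ (n , a , p) → same (proj₂ (predecessor (A⁺ a))) p
  ; to-from = λ _ → refl
  ; xdeg-to = λ (_ , _ , p) → p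
  ; qdeg-to = λ _ → refl }
  where
  predecessor : ∀ {m} → 0 < m → ∃ λ n → m ≡ suc n
  predecessor (s≤s _) = _ , refl
  same : ∀ {a n n′} (p′ : xdeg A a ≡ suc n′) (p : xdeg A a ≡ suc n) →
         _≡_ {A = Obj (Σᶜ ℕ (λ n → atX (suc n) (Fibre A (suc n))))} (n′ , a , p′) (n , a , p)
  same p′ p with refl ← ℕₚ.suc-injective (trans (sym p′) p) = cong (λ p → _ , _ , p) (uip p′ p)

Σᶜ-atX-⊗ : ∀ (f g : ℕ → ℕ) (X Y : ℕ → Class) →
           Σᶜ (ℕ × ℕ) (λ (a , b) → atX (f a + g b) (X a ⊗ Y b)) ≅
           Σᶜ ℕ (λ a → atX (f a) (X a)) ⊗ Σᶜ ℕ (λ b → atX (g b) (Y b))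
Σᶜ-atX-⊗ f g X Y = record
  { to      = λ ((a , b) , x , y) → (a , x) , (b , y)
  ; from    = λ ((a , x) , (b , y)) → (a , b) , x , y
  ; from-to = λ _ → refl
  ; to-from = λ _ → refl
  ; xdeg-to = λ _ → refl
  ; qdeg-to = λ _ → refl }

Σᶜ-atX-suc : ∀ (f : ℕ → ℕ) (X : ℕ → Class) →
             Σᶜ ℕ (λ m → atX (suc (f m)) (X m)) ≅ 𝕩 ⊗ Σᶜ ℕ (λ m → atX (f m) (X m))
Σᶜ-atX-suc f X = record
  { to = λ (m , x) → tt , m , x ; from = λ (_ , m , x) → m , x
  ; from-to = λ _ → refl ; to-from = λ _ → refl ; xdeg-to = λ _ → refl ; qdeg-to = λ _ → refl }

module _ {A B : Class} (A⁺ : Positive A) (B⁺ : Positive B) (e : 𝟙 ⊕ A ≅ 𝟙 ⊕ B) where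

  private
    -- the only object of x-degree 0 is inj₁ tt
    inj₂-positive : ∀ {C} (s : Obj (𝟙 ⊕ C)) → 0 < xdeg (𝟙 ⊕ C) s → ∃ λ c → inj₂ c ≡ s
    inj₂-positive (inj₂ c) _ = c , refl

    image : ∀ {C D} → Positive C → (i : 𝟙 ⊕ C ≅ 𝟙 ⊕ D) → ∀ c → ∃ λ d → inj₂ d ≡ to i (inj₂ c)
    image C⁺ i c = inj₂-positive (to i (inj₂ c)) (subst (0 <_) (sym (xdeg-to i (inj₂ c))) (C⁺ c))

    t : Obj A → Obj B
    t a = proj₁ (image A⁺ e a)

    f : Obj B → Obj A
    f b = proj₁ (image B⁺ (≅-sym e) b)

    inj₂-t : ∀ a → inj₂ (t a) ≡ to e (inj₂ a)
    inj₂-t a = proj₂ (image A⁺ e a)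

    inj₂-f : ∀ b → inj₂ (f b) ≡ from e (inj₂ b)
    inj₂-f b = proj₂ (image B⁺ (≅-sym e) b)

  𝟙⊕-cancel : A ≅ B
  𝟙⊕-cancel = record
    { to      = t
    ; from    = f
    ; from-to = λ a → inj₂-injective (trans (inj₂-f (t a)) (trans (cong (from e) (inj₂-t a)) (from-to e (inj₂ a))))
    ; to-from = λ b → inj₂-injective (trans (inj₂-t (f b)) (trans (cong (to e) (inj₂-f b)) (to-from e (inj₂ b))))
    ; xdeg-to = λ a → trans (cong (xdeg (𝟙 ⊕ B)) (inj₂-t a)) (xdeg-to e (inj₂ a))
    ; qdeg-to = λ a → trans (cong (qdeg (𝟙 ⊕ B)) (inj₂-t a)) (qdeg-to e (inj₂ a)) }

module _ {R Y G : Class} (e : R ≅ Y ⊕ G ⊗ R) (G⁺ : Positive G) where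

  unroll : List (Obj G) → Obj Y → Obj R
  unroll []       y = from e (inj₁ y)
  unroll (g ∷ gs) y = from e (inj₂ (g , unroll gs y))

  unroll-xdeg : ∀ gs y → xdeg R (unroll gs y) ≡ xdeg (Seq G ⊗ Y) (gs , y)
  unroll-xdeg []       y = xdeg-to (≅-sym e) (inj₁ y)
  unroll-xdeg (g ∷ gs) y =
    trans (xdeg-to (≅-sym e) (inj₂ (g , unroll gs y)))
          (trans (cong (xdeg G g +_) (unroll-xdeg gs y)) (sym (ℕₚ.+-assoc (xdeg G g) _ _)))

  unroll-qdeg : ∀ gs y → qdeg R (unroll gs y) ≡ qdeg (Seq G ⊗ Y) (gs , y)
  unroll-qdeg []       y = qdeg-to (≅-sym e) (inj₁ y)
  unroll-qdeg (g ∷ gs) y =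
    trans (qdeg-to (≅-sym e) (inj₂ (g , unroll gs y)))
          (trans (cong (qdeg G g +_) (unroll-qdeg gs y)) (sym (ℕₚ.+-assoc (qdeg G g) _ _)))

  unroll-injective : ∀ gs y gs′ y′ → unroll gs y ≡ unroll gs′ y′ → (gs , y) ≡ (gs′ , y′)
  unroll-injective []       y []         y′ p = cong ([] ,_) (inj₁-injective (≅-from-injective e p))
  unroll-injective []       _ (_ ∷ _)    _  p with () ← ≅-from-injective e p
  unroll-injective (_ ∷ _)  _ []         _  p with () ← ≅-from-injective e p
  unroll-injective (g ∷ gs) y (g′ ∷ gs′) y′ p
    with refl , q ← ,-injective (inj₂-injective (≅-from-injective e p))
    with refl ← unroll-injective gs y gs′ y′ q = refl

  private
    shrinks : ∀ {r g r′} → to e r ≡ inj₂ (g , r′) → xdeg R r′ < xdeg R r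
    shrinks {r} {g} {r′} eq =
      subst (xdeg R r′ <_) (trans (sym (cong (xdeg (Y ⊕ G ⊗ R)) eq)) (xdeg-to e r))
            (ℕₚ.+-monoˡ-≤ (xdeg R r′) (G⁺ g))

    unrolled : ∀ {r s} → to e r ≡ s → from e s ≡ r
    unrolled {r} eq = trans (cong (from e) (sym eq)) (from-to e r)

  unroll-surjective : ∀ r → Acc _<_ (xdeg R r) → ∃ λ (gs , y) → unroll gs y ≡ r
  unroll-surjective r (acc rec) with to e r in eq
  ... | inj₁ y = ([] , y) , unrolled eq
  ... | inj₂ (g , r′) with unroll-surjective r′ (rec (shrinks eq))
  ...   | (gs , y) , p = (g ∷ gs , y) , trans (cong (λ z → from e (inj₂ (g , z))) p) (unrolled eq)

  solve-linear : R ≅ Seq G ⊗ Y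
  solve-linear = record
    { to      = λ r → proj₁ (preimage r)
    ; from    = λ (gs , y) → unroll gs y
    ; from-to = λ r → proj₂ (preimage r)
    ; to-from = λ (gs , y) → unroll-injective _ _ gs y (proj₂ (preimage (unroll gs y)))
    ; xdeg-to = λ r → let ((gs , y) , p) = preimage r in trans (sym (unroll-xdeg gs y)) (cong (xdeg R) p)
    ; qdeg-to = λ r → let ((gs , y) , p) = preimage r in trans (sym (unroll-qdeg gs y)) (cong (qdeg R) p) }
    where
    preimage : ∀ r → ∃ λ (gs , y) → unroll gs y ≡ r
    preimage r = unroll-surjective r (<-wellFounded (xdeg R r))

-- Polynomials in q as classes of terms

atDegree : ℕ → Set → Class
atDegree j X = mkClass X (λ _ → 0) (λ _ → j)

Const : ℕ → Class
Const a = atDegree 0 (Fin a)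

CoeffClass : (ℕ → ℕ) → Class
CoeffClass c = Σᶜ ℕ (λ j → atDegree j (Fin (c j)))

Terms : Poly → Class
Terms p = CoeffClass (coeff p)

↔⇒≅ : ∀ {j X X′} → X ↔ X′ → atDegree j X ≅ atDegree j X′
↔⇒≅ i = record
  { to = Inverse.to i ; from = Inverse.from i
  ; from-to = Inverse.strictlyInverseʳ i ; to-from = Inverse.strictlyInverseˡ i
  ; xdeg-to = λ _ → refl ; qdeg-to = λ _ → refl }

atDegree-⊎ : ∀ {j X X′} → atDegree j (X ⊎ X′) ≅ atDegree j X ⊕ atDegree j X′
atDegree-⊎ = record
  { to = λ s → s ; from = λ s → s ; from-to = λ _ → refl ; to-from = λ _ → refl
  ; xdeg-to = λ { (inj₁ _) → refl ; (inj₂ _) → refl }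
  ; qdeg-to = λ { (inj₁ _) → refl ; (inj₂ _) → refl } }

CoeffClass-cong : ∀ {c c′} → (∀ j → c j ≡ c′ j) → CoeffClass c ≅ CoeffClass c′
CoeffClass-cong c≡c′ = Σᶜ-cong (λ j → ≡⇒≅ (cong (λ n → atDegree j (Fin n)) (c≡c′ j)))

CoeffClass-+ : ∀ c c′ → CoeffClass (λ j → c j + c′ j) ≅ CoeffClass c ⊕ CoeffClass c′
CoeffClass-+ c c′ = Σᶜ-cong (λ j → ↔⇒≅ Finₚ.+↔⊎ ⟫ atDegree-⊎) ⟫ Σᶜ-⊕

CoeffClass-* : ∀ a c → CoeffClass (λ j → a * c j) ≅ Const a ⊗ CoeffClass c
CoeffClass-* a c = Σᶜ-cong (λ j → ↔⇒≅ Finₚ.*↔×) ⟫ Σᶜ-⊗ˡ {A = Const a}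

coeff-+ₚ : ∀ p p′ j → coeff (p +ₚ p′) j ≡ coeff p j + coeff p′ j
coeff-+ₚ []      p′       j       = refl
coeff-+ₚ (a ∷ p) []       j       = sym (ℕₚ.+-identityʳ _)
coeff-+ₚ (a ∷ p) (b ∷ p′) zero    = refl
coeff-+ₚ (a ∷ p) (b ∷ p′) (suc j) = coeff-+ₚ p p′ j

coeff-scaleₚ : ∀ a p j → coeff (scaleₚ a p) j ≡ a * coeff p j
coeff-scaleₚ a []      j       = sym (ℕₚ.*-zeroʳ a)
coeff-scaleₚ a (b ∷ p) zero    = refl
coeff-scaleₚ a (b ∷ p) (suc j) = coeff-scaleₚ a p j

Terms-+ₚ : ∀ p p′ → Terms (p +ₚ p′) ≅ Terms p ⊕ Terms p′
Terms-+ₚ p p′ = CoeffClass-cong (coeff-+ₚ p p′) ⟫ CoeffClass-+ (coeff p) (coeff p′)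

Terms-scaleₚ : ∀ a p → Terms (scaleₚ a p) ≅ Const a ⊗ Terms p
Terms-scaleₚ a p = CoeffClass-cong (coeff-scaleₚ a p) ⟫ CoeffClass-* a (coeff p)

Terms-∷ : ∀ a p → Terms (a ∷ p) ≅ Const a ⊕ 𝕢 ⊗ Terms p
Terms-∷ a p = record
  { to      = λ { (zero , i) → inj₁ i ; (suc j , i) → inj₂ (tt , (j , i)) }
  ; from    = λ { (inj₁ i) → zero , i ; (inj₂ (_ , (j , i))) → suc j , i }
  ; from-to = λ { (zero , _) → refl ; (suc _ , _) → refl }
  ; to-from = λ { (inj₁ _) → refl ; (inj₂ _) → refl }
  ; xdeg-to = λ { (zero , _) → refl ; (suc _ , _) → refl }
  ; qdeg-to = λ { (zero , _) → refl ; (suc _ , _) → refl } }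

Terms-[] : Terms [] ≅ 𝟘
Terms-[] = record
  { to = λ () ; from = λ () ; from-to = λ () ; to-from = λ ()
  ; xdeg-to = λ () ; qdeg-to = λ () }

Const-0 : Const 0 ≅ 𝟘
Const-0 = record
  { to = λ () ; from = λ () ; from-to = λ () ; to-from = λ ()
  ; xdeg-to = λ () ; qdeg-to = λ () }

Terms-0∷ : ∀ p → Terms (0 ∷ p) ≅ 𝕢 ⊗ Terms p
Terms-0∷ p = Terms-∷ 0 p ⟫ ⊕-cong Const-0 ≅-refl ⟫ ⊕-identityˡ {𝕢 ⊗ Terms p}

Terms-*ₚ : ∀ p p′ → Terms (p *ₚ p′) ≅ Terms p ⊗ Terms p′
Terms-*ₚ []      p′ = Terms-[] ⟫ ≅-sym (⊗-zeroˡ {Terms p′}) ⟫ ⊗-congʳ {B = Terms p′} (≅-sym Terms-[])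
Terms-*ₚ (a ∷ p) p′ =
  Terms-+ₚ (scaleₚ a p′) (0 ∷ (p *ₚ p′))
  ⟫ ⊕-cong (Terms-scaleₚ a p′)
           (Terms-0∷ (p *ₚ p′) ⟫ ⊗-congˡ {𝕢} (Terms-*ₚ p p′) ⟫ ≅-sym (⊗-assoc {𝕢} {Terms p} {Terms p′}))
  ⟫ ≅-sym (⊗-distribʳ-⊕ {Terms p′} {Const a} {𝕢 ⊗ Terms p})
  ⟫ ⊗-congʳ (≅-sym (Terms-∷ a p))

Terms-qpow : ∀ m → Terms (qpow m) ≅ atDegree m ⊤
Terms-qpow zero    = Terms-∷ 1 [] ⟫ ⊕-cong one (⊗-congˡ {𝕢} Terms-[] ⟫ ⊗-zeroʳ {𝕢}) ⟫ ⊕-identityʳ {𝟙}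
  where
  one : Const 1 ≅ 𝟙
  one = record
    { to = λ _ → tt ; from = λ _ → Fin.zero
    ; from-to = λ { Fin.zero → refl } ; to-from = λ _ → refl
    ; xdeg-to = λ _ → refl ; qdeg-to = λ _ → refl }
Terms-qpow (suc m) = Terms-0∷ (qpow m) ⟫ ⊗-congˡ (Terms-qpow m) ⟫ record
  { to = proj₂ ; from = tt ,_ ; from-to = λ _ → refl ; to-from = λ _ → refl
  ; xdeg-to = λ _ → refl ; qdeg-to = λ _ → refl }

Terms-1ₚ : Terms 1ₚ ≅ 𝟙
Terms-1ₚ = Terms-qpow 0

Terms-if : ∀ b p → Terms (if b then p else 0ₚ) ≅ atDegree 0 (T b) ⊗ Terms p
Terms-if true  p = ≅-sym ⊗-identityˡ
Terms-if false p = Terms-[] ⟫ record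
  { to = λ () ; from = λ () ; from-to = λ () ; to-from = λ ()
  ; xdeg-to = λ () ; qdeg-to = λ () }

Terms-sumₚ-++ : ∀ ps ps′ → Terms (sumₚ (ps ++ ps′)) ≅ Terms (sumₚ ps) ⊕ Terms (sumₚ ps′)
Terms-sumₚ-++ []       ps′ = ≅-sym (⊕-cong Terms-[] ≅-refl ⟫ ⊕-identityˡ)
Terms-sumₚ-++ (p ∷ ps) ps′ =
  Terms-+ₚ p (sumₚ (ps ++ ps′)) ⟫ ⊕-cong ≅-refl (Terms-sumₚ-++ ps ps′)
  ⟫ ≅-sym ⊕-assoc ⟫ ⊕-cong (≅-sym (Terms-+ₚ p (sumₚ ps))) ≅-refl

Terms-nonzero : ∀ p → Obj (Terms p) → isZeroₚ p ≡ false
Terms-nonzero (zero  ∷ p) (suc j , i) = Terms-nonzero p (j , i)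
Terms-nonzero (suc a ∷ p) _           = refl

module _ {p p′ : Poly} (e : Terms p ≅ Terms p′) where

  -- an isomorphism preserves q-degrees, so it restricts to the copies of q ^ j
  onDegree : ∀ j → Fin (coeff p j) → Fin (coeff p′ j)
  onDegree j i = subst (λ k → Fin (coeff p′ k)) (qdeg-to e (j , i)) (proj₂ (to e (j , i)))

  private
    unsubst : ∀ {F : ℕ → Set} {k k′ j} (q : k ≡ j) (q′ : k′ ≡ j) {x : F k} {x′ : F k′} →
              subst F q x ≡ subst F q′ x′ → _≡_ {A = Σ ℕ F} (k , x) (k′ , x′)
    unsubst refl refl refl = refl

    sameDegree : ∀ {j} {i i′ : Fin (coeff p j)} → _≡_ {A = Σ ℕ (λ k → Fin (coeff p k))} (j , i) (j , i′) → i ≡ i′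
    sameDegree refl = refl

  onDegree-injective : ∀ j {i i′} → onDegree j i ≡ onDegree j i′ → i ≡ i′
  onDegree-injective j {i} {i′} eq =
    sameDegree (≅-to-injective e (unsubst (qdeg-to e (j , i)) (qdeg-to e (j , i′)) eq))

coeff-≅ : ∀ {p p′} → Terms p ≅ Terms p′ → ∀ j → coeff p j ≡ coeff p′ j
coeff-≅ {p} {p′} e j =
  Finₚ.cantor-schröder-bernstein (onDegree-injective {p} {p′} e j) (onDegree-injective {p′} {p} (≅-sym e) j)

[1+q] : Poly
[1+q] = 1 ∷ 1 ∷ []

coeff-scaleₚ-1 : ∀ s j → coeff (scaleₚ 1 s) j ≡ coeff s j
coeff-scaleₚ-1 s j = trans (coeff-scaleₚ 1 s j) (ℕₚ.*-identityˡ _)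

coeff-1ₚ*ₚ : ∀ s j → coeff (1ₚ *ₚ s) j ≡ coeff s j
coeff-1ₚ*ₚ s j =
  trans (coeff-+ₚ (scaleₚ 1 s) (0 ∷ []) j) (trans (cong₂ _+_ (coeff-scaleₚ-1 s j) (coeff-0∷[] j)) (ℕₚ.+-identityʳ _))
  where
  coeff-0∷[] : ∀ j → coeff (0 ∷ []) j ≡ 0
  coeff-0∷[] zero    = refl
  coeff-0∷[] (suc j) = refl

coeff-[1+q]*ₚ : ∀ s j → coeff ([1+q] *ₚ s) (suc j) ≡ coeff s (suc j) + coeff s j
coeff-[1+q]*ₚ s j = trans (coeff-+ₚ (scaleₚ 1 s) _ (suc j)) (cong₂ _+_ (coeff-scaleₚ-1 s (suc j)) (coeff-1ₚ*ₚ s j))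

coeff₀-[1+q]*ₚ : ∀ s → coeff ([1+q] *ₚ s) 0 ≡ coeff s 0 + 0
coeff₀-[1+q]*ₚ s = trans (coeff-+ₚ (scaleₚ 1 s) _ 0) (cong (_+ 0) (coeff-scaleₚ-1 s 0))

-- the local loop of divOnePlusQ with an arbitrary previous quotient coefficient, reached through its first step
divFrom : ℕ → Poly → Poly
divFrom prev cs = drop 1 (divOnePlusQ (prev ∷ cs))

coeff-divFrom : ∀ cs prev (f : ℕ → ℕ) → coeff cs 0 ≡ f 0 + prev → (∀ j → coeff cs (suc j) ≡ f (suc j) + f j) →
                ∀ j → coeff (divFrom prev cs) j ≡ f j
coeff-divFrom [] prev f eq₀ eq j = sym (vanishes j)
  where
  vanishes : ∀ j → f j ≡ 0
  vanishes zero    = ℕₚ.m+n≡0⇒m≡0 (f 0) (sym eq₀)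
  vanishes (suc j) = ℕₚ.m+n≡0⇒m≡0 (f (suc j)) (sym (eq j))
coeff-divFrom (c ∷ cs) prev f eq₀ eq zero = trans (cong (_∸ prev) eq₀) (ℕₚ.m+n∸n≡m (f 0) prev)
coeff-divFrom (c ∷ cs) prev f eq₀ eq (suc j) =
  coeff-divFrom cs (c ∸ prev) (λ i → f (suc i))
    (trans (eq 0) (cong (f 1 +_) (sym (coeff-divFrom (c ∷ cs) prev f eq₀ eq zero))))
    (λ i → eq (suc i)) j

divOnePlusQ-exact : ∀ c s → Terms c ≅ Terms ([1+q] *ₚ s) → Terms (divOnePlusQ c) ≅ Terms s
divOnePlusQ-exact c s e = CoeffClass-cong (coeff-divFrom c 0 (coeff s)
  (trans (coeff-≅ {c} {[1+q] *ₚ s} e 0) (coeff₀-[1+q]*ₚ s))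
  (λ j → trans (coeff-≅ {c} {[1+q] *ₚ s} e (suc j)) (coeff-[1+q]*ₚ s j)))

-- Schröder paths

Paths : ℕ → Set
Paths m = Σ (List Step) (λ p → size p ≡ m)

pathSum : ℕ → (List Step → Poly) → Class
pathSum m f = Σᶜ (Paths m) (λ (p , _) → Terms (f p))

size≡0 : ∀ p → size p ≡ 0 → p ≡ []
size≡0 [] _ = refl
size≡0 (U ∷ _) ()
size≡0 (D ∷ _) ()
size≡0 (H ∷ _) ()

Paths-≡ : ∀ {m p p′} {e : size p ≡ m} {e′ : size p′ ≡ m} → p ≡ p′ → (p , e) ≡ (p′ , e′)
Paths-≡ {p = p} refl = cong (p ,_) (uip _ _)

Paths-0 : ⊤ ↔ Paths 0
Paths-0 = mk↔ₛ′ (λ _ → [] , refl) (λ _ → tt) (λ (p , e) → Paths-≡ (sym (size≡0 p e))) (λ _ → refl)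

Paths-1 : (⊤ ⊎ ⊤) ↔ Paths 1
Paths-1 = mk↔ₛ′ enc dec enc-dec λ { (inj₁ _) → refl ; (inj₂ _) → refl }
  where
  enc : ⊤ ⊎ ⊤ → Paths 1
  enc (inj₁ _) = U ∷ [] , refl
  enc (inj₂ _) = D ∷ [] , refl
  dec : Paths 1 → ⊤ ⊎ ⊤
  dec (U ∷ _ , _) = inj₁ tt
  dec (D ∷ _ , _) = inj₂ tt
  enc-dec : ∀ s → enc (dec s) ≡ s
  enc-dec (U ∷ p , e) = Paths-≡ (cong (U ∷_) (sym (size≡0 p (ℕₚ.suc-injective e))))
  enc-dec (D ∷ p , e) = Paths-≡ (cong (D ∷_) (sym (size≡0 p (ℕₚ.suc-injective e))))

Paths-2+ : ∀ m → (Paths (suc m) ⊎ Paths (suc m) ⊎ Paths m) ↔ Paths (suc (suc m))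
Paths-2+ m = mk↔ₛ′ enc dec enc-dec dec-enc
  where
  enc : Paths (suc m) ⊎ Paths (suc m) ⊎ Paths m → Paths (suc (suc m))
  enc (inj₁ (p , e))        = U ∷ p , cong suc e
  enc (inj₂ (inj₁ (p , e))) = D ∷ p , cong suc e
  enc (inj₂ (inj₂ (p , e))) = H ∷ p , cong (λ k → suc (suc k)) e
  dec : Paths (suc (suc m)) → Paths (suc m) ⊎ Paths (suc m) ⊎ Paths m
  dec (U ∷ p , e) = inj₁ (p , ℕₚ.suc-injective e)
  dec (D ∷ p , e) = inj₂ (inj₁ (p , ℕₚ.suc-injective e))
  dec (H ∷ p , e) = inj₂ (inj₂ (p , ℕₚ.suc-injective (ℕₚ.suc-injective e)))
  enc-dec : ∀ s → enc (dec s) ≡ s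
  enc-dec (U ∷ _ , _) = Paths-≡ refl
  enc-dec (D ∷ _ , _) = Paths-≡ refl
  enc-dec (H ∷ _ , _) = Paths-≡ refl
  dec-enc : ∀ s → dec (enc s) ≡ s
  dec-enc (inj₁ _)        = cong inj₁ (Paths-≡ refl)
  dec-enc (inj₂ (inj₁ _)) = cong (λ s → inj₂ (inj₁ s)) (Paths-≡ refl)
  dec-enc (inj₂ (inj₂ _)) = cong (λ s → inj₂ (inj₂ s)) (Paths-≡ refl)

pathSum-0 : ∀ f → pathSum 0 f ≅ Terms (f [])
pathSum-0 f = Σᶜ-reindex Paths-0 ⟫ Σᶜ-⊤

pathSum-1 : ∀ f → pathSum 1 f ≅ Terms (f (U ∷ [])) ⊕ Terms (f (D ∷ []))
pathSum-1 f = Σᶜ-reindex Paths-1 ⟫ Σᶜ-⊎ _ ⟫ ⊕-cong Σᶜ-⊤ Σᶜ-⊤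

pathSum-2+ : ∀ m f → pathSum (suc (suc m)) f ≅
             pathSum (suc m) (λ p → f (U ∷ p)) ⊕ pathSum (suc m) (λ p → f (D ∷ p)) ⊕ pathSum m (λ p → f (H ∷ p))
pathSum-2+ m f = Σᶜ-reindex (Paths-2+ m) ⟫ Σᶜ-⊎ _ ⟫ ⊕-cong ≅-refl (Σᶜ-⊎ _)

Terms-sum-allSeqs : ∀ m f → Terms (sumₚ (map f (allSeqs m))) ≅ pathSum m f
Terms-sum-allSeqs zero f = Terms-+ₚ (f []) [] ⟫ ⊕-cong ≅-refl Terms-[] ⟫ ⊕-identityʳ ⟫ ≅-sym (pathSum-0 f)
Terms-sum-allSeqs (suc zero) f =
  Terms-+ₚ (f (U ∷ [])) _ ⟫ ⊕-cong ≅-refl (Terms-+ₚ (f (D ∷ [])) [] ⟫ ⊕-cong ≅-refl Terms-[] ⟫ ⊕-identityʳ)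
  ⟫ ≅-sym (pathSum-1 f)
Terms-sum-allSeqs (suc (suc m)) f =
  split (map (U ∷_) (allSeqs (suc m))) _
  ⟫ ⊕-cong (first U (suc m))
      (split (map (D ∷_) (allSeqs (suc m))) _ ⟫ ⊕-cong (first D (suc m)) (first H m))
  ⟫ ≅-sym (pathSum-2+ m f)
  where
  split : ∀ ps ps′ → Terms (sumₚ (map f (ps ++ ps′))) ≅ Terms (sumₚ (map f ps)) ⊕ Terms (sumₚ (map f ps′))
  split ps ps′ = ≡⇒≅ (cong (λ z → Terms (sumₚ z)) (Listₚ.map-++ f ps ps′)) ⟫ Terms-sumₚ-++ (map f ps) _
  first : ∀ s k → Terms (sumₚ (map f (map (s ∷_) (allSeqs k)))) ≅ pathSum k (λ p → f (s ∷ p))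
  first s k = ≡⇒≅ (cong (λ z → Terms (sumₚ z)) (sym (Listₚ.map-∘ (allSeqs k))))
              ⟫ Terms-sum-allSeqs k (λ p → f (s ∷ p))

-- Schröder paths by first-return decomposition: ε, H P, U P D P′
data STree : Set where
  leaf  : STree
  hstep : STree → STree
  arch  : STree → STree → STree

flatten : STree → List Step
flatten leaf       = []
flatten (hstep t)  = H ∷ flatten t
flatten (arch a b) = U ∷ flatten a ++ D ∷ flatten b

nodes : STree → ℕ
nodes leaf       = 0
nodes (hstep t)  = suc (nodes t)
nodes (arch a b) = suc (nodes a + nodes b)

hsteps : STree → ℕ
hsteps leaf       = 0
hsteps (hstep t)  = suc (hsteps t)
hsteps (arch a b) = hsteps a + hsteps b

𝒮 : Class
𝒮 = mkClass STree nodes hsteps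

semilength : List Step → ℕ
semilength []      = 0
semilength (U ∷ p) = suc (semilength p)
semilength (D ∷ p) = semilength p
semilength (H ∷ p) = suc (semilength p)

SchröderPaths : Class
SchröderPaths = mkClass (Σ (List Step) (λ p → T (schFrom 0 p))) (λ (p , _) → semilength p) (λ (p , _) → numH p)

schFrom-U : ∀ h p → schFrom h (U ∷ p) ≡ schFrom (suc h) p
schFrom-U zero    p = refl
schFrom-U (suc h) p = refl

schFrom-H : ∀ h p → schFrom h (H ∷ p) ≡ schFrom h p
schFrom-H zero    p = refl
schFrom-H (suc h) p = refl

schFrom-++ : ∀ j m a b → T (schFrom j a) → T (schFrom m b) → T (schFrom (j + m) (a ++ b))
schFrom-++ zero    m []      b _  tb = tb
schFrom-++ j       m (U ∷ a) b ta tb =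
  subst T (sym (schFrom-U (j + m) (a ++ b))) (schFrom-++ (suc j) m a b (subst T (schFrom-U j a) ta) tb)
schFrom-++ (suc j) m (D ∷ a) b ta tb = schFrom-++ j m a b ta tb
schFrom-++ j       m (H ∷ a) b ta tb =
  subst T (sym (schFrom-H (j + m) (a ++ b))) (schFrom-++ j m a b (subst T (schFrom-H j a) ta) tb)

flatten-valid : ∀ t → T (schFrom 0 (flatten t))
flatten-valid leaf       = tt
flatten-valid (hstep t)  = flatten-valid t
flatten-valid (arch a b) = schFrom-++ 0 1 (flatten a) (D ∷ flatten b) (flatten-valid a) (flatten-valid b)

semilength-++ : ∀ a b → semilength (a ++ b) ≡ semilength a + semilength b
semilength-++ []      b = refl
semilength-++ (U ∷ a) b = cong suc (semilength-++ a b)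
semilength-++ (D ∷ a) b = semilength-++ a b
semilength-++ (H ∷ a) b = cong suc (semilength-++ a b)

numH-++ : ∀ a b → numH (a ++ b) ≡ numH a + numH b
numH-++ []      b = refl
numH-++ (U ∷ a) b = numH-++ a b
numH-++ (D ∷ a) b = numH-++ a b
numH-++ (H ∷ a) b = cong suc (numH-++ a b)

semilength-flatten : ∀ t → semilength (flatten t) ≡ nodes t
semilength-flatten leaf      = refl
semilength-flatten (hstep t) = cong suc (semilength-flatten t)
semilength-flatten (arch a b) =
  cong suc (trans (semilength-++ (flatten a) (D ∷ flatten b)) (cong₂ _+_ (semilength-flatten a) (semilength-flatten b)))

numH-flatten : ∀ t → numH (flatten t) ≡ hsteps t
numH-flatten leaf       = refl
numH-flatten (hstep t)  = cong suc (numH-flatten t)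
numH-flatten (arch a b) = trans (numH-++ (flatten a) (D ∷ flatten b)) (cong₂ _+_ (numH-flatten a) (numH-flatten b))

FirstReturn : ℕ → ℕ → List Step → Set
FirstReturn j m p = ∃ λ ((a , b) : List Step × List Step) → p ≡ a ++ D ∷ b × T (schFrom j a) × T (schFrom m b)

firstReturn : ∀ j m p → T (schFrom (suc (j + m)) p) → FirstReturn j m p
firstReturn j m (U ∷ p) v with firstReturn (suc j) m p v
... | (a , b) , refl , va , vb = (U ∷ a , b) , refl , subst T (sym (schFrom-U j a)) va , vb
firstReturn zero m (D ∷ p) v = ([] , p) , refl , tt , v
firstReturn (suc j) m (D ∷ p) v with firstReturn j m p v
... | (a , b) , refl , va , vb = (D ∷ a , b) , refl , va , vb
firstReturn j m (H ∷ p) v with firstReturn j m p v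
... | (a , b) , refl , va , vb = (H ∷ a , b) , refl , subst T (sym (schFrom-H j a)) va , vb

-- the D right after a is the first step below the axis, so it marks the same position in both splits
firstReturn-unique : ∀ j a a′ r r′ → T (schFrom j a) → T (schFrom j a′) → a ++ D ∷ r ≡ a′ ++ D ∷ r′ → a ≡ a′
firstReturn-unique zero    []      []       r r′ _  _   _ = refl
firstReturn-unique j       (U ∷ a) (U ∷ a′) r r′ va va′ e =
  cong (U ∷_) (firstReturn-unique (suc j) a a′ r r′ (subst T (schFrom-U j a) va) (subst T (schFrom-U j a′) va′)
                                  (Listₚ.∷-injectiveʳ e))
firstReturn-unique (suc j) (D ∷ a) (D ∷ a′) r r′ va va′ e =
  cong (D ∷_) (firstReturn-unique j a a′ r r′ va va′ (Listₚ.∷-injectiveʳ e))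
firstReturn-unique j       (H ∷ a) (H ∷ a′) r r′ va va′ e =
  cong (H ∷_) (firstReturn-unique j a a′ r r′ (subst T (schFrom-H j a) va) (subst T (schFrom-H j a′) va′)
                                  (Listₚ.∷-injectiveʳ e))
firstReturn-unique zero    []      (U ∷ _)  _ _  _  _   ()
firstReturn-unique zero    []      (H ∷ _)  _ _  _  _   ()
firstReturn-unique zero    (U ∷ _) []       _ _  _  _   ()
firstReturn-unique zero    (H ∷ _) []       _ _  _  _   ()
firstReturn-unique _       (U ∷ _) (D ∷ _)  _ _  _  _   ()
firstReturn-unique _       (U ∷ _) (H ∷ _)  _ _  _  _   ()
firstReturn-unique _       (D ∷ _) (U ∷ _)  _ _  _  _   ()
firstReturn-unique _       (D ∷ _) (H ∷ _)  _ _  _  _   ()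
firstReturn-unique _       (H ∷ _) (U ∷ _)  _ _  _  _   ()
firstReturn-unique _       (H ∷ _) (D ∷ _)  _ _  _  _   ()

flatten-injective : ∀ t t′ → flatten t ≡ flatten t′ → t ≡ t′
flatten-injective leaf       leaf         _ = refl
flatten-injective (hstep t)  (hstep t′)   e = cong hstep (flatten-injective t t′ (Listₚ.∷-injectiveʳ e))
flatten-injective (arch a b) (arch a′ b′) e
  with refl ← flatten-injective a a′
                (firstReturn-unique 0 (flatten a) (flatten a′) (flatten b) (flatten b′)
                   (flatten-valid a) (flatten-valid a′) (Listₚ.∷-injectiveʳ e))
  = cong (arch a) (flatten-injective b b′ (Listₚ.∷-injectiveʳ (Listₚ.++-cancelˡ (flatten a) _ _ (Listₚ.∷-injectiveʳ e))))

private
  shorterˡ : ∀ (a b : List Step) → length a < length (U ∷ a ++ D ∷ b)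
  shorterˡ a b = s≤s (subst (length a ≤_) (sym (Listₚ.length-++ a)) (ℕₚ.m≤m+n _ _))

  shorterʳ : ∀ (a b : List Step) → length b < length (U ∷ a ++ D ∷ b)
  shorterʳ a b = s≤s (subst (length b ≤_) (sym (Listₚ.length-++ a)) (ℕₚ.≤-trans (ℕₚ.n≤1+n _) (ℕₚ.m≤n+m _ _)))

parse : ∀ p → Acc _<_ (length p) → T (schFrom 0 p) → ∃ λ t → flatten t ≡ p
parse []      _         _ = leaf , refl
parse (H ∷ p) (acc rec) v with parse p (rec ℕₚ.≤-refl) v
... | t , refl = hstep t , refl
parse (U ∷ p) (acc rec) v with firstReturn 0 0 p v
... | (a , b) , refl , va , vb
  with parse a (rec (shorterˡ a b)) va | parse b (rec (shorterʳ a b)) vb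
... | ta , refl | tb , refl = arch ta tb , refl

SchröderPaths≅𝒮 : SchröderPaths ≅ 𝒮
SchröderPaths≅𝒮 = record
  { to      = λ s → proj₁ (tree s)
  ; from    = λ t → flatten t , flatten-valid t
  ; from-to = λ s → flattened s (tree s)
  ; to-from = λ t → flatten-injective _ t (proj₂ (tree (flatten t , flatten-valid t)))
  ; xdeg-to = λ s → trans (sym (semilength-flatten (proj₁ (tree s)))) (cong semilength (proj₂ (tree s)))
  ; qdeg-to = λ s → trans (sym (numH-flatten (proj₁ (tree s)))) (cong numH (proj₂ (tree s))) }
  where
  tree : (s : Obj SchröderPaths) → ∃ λ t → flatten t ≡ proj₁ s
  tree (p , v) = parse p (<-wellFounded (length p)) v
  flattened : ∀ s (w : ∃ λ t → flatten t ≡ proj₁ s) → (flatten (proj₁ w) , flatten-valid (proj₁ w)) ≡ s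
  flattened (p , v) (t , refl) = cong (flatten t ,_) (Boolₚ.T-irrelevant _ _)

size≡2*semilength : ∀ h p → T (schFrom h p) → size p ≡ 2 * semilength p + h
size≡2*semilength zero    []      _ = refl
size≡2*semilength h       (U ∷ p) v =
  trans (cong suc (size≡2*semilength (suc h) p (subst T (schFrom-U h p) v))) (arith (semilength p) h)
  where
  arith : ∀ a h → suc (2 * a + suc h) ≡ 2 * suc a + h
  arith = solve-∀
size≡2*semilength (suc h) (D ∷ p) v = trans (cong suc (size≡2*semilength h p v)) (sym (ℕₚ.+-suc _ h))
size≡2*semilength h       (H ∷ p) v =
  trans (cong (λ k → suc (suc k)) (size≡2*semilength h p (subst T (schFrom-H h p) v))) (arith (semilength p) h)
  where
  arith : ∀ a h → suc (suc (2 * a + h)) ≡ 2 * suc a + h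
  arith = solve-∀

semilength-of-size : ∀ n p → T (schFrom 0 p) → size p ≡ 2 * n → semilength p ≡ n
semilength-of-size n p v e =
  ℕₚ.*-cancelˡ-≡ (semilength p) n 2 (trans (sym (trans (size≡2*semilength 0 p v) (ℕₚ.+-identityʳ _))) e)

size-of-semilength : ∀ n p → T (schFrom 0 p) → semilength p ≡ n → size p ≡ 2 * n
size-of-semilength n p v e = trans (trans (size≡2*semilength 0 p v) (ℕₚ.+-identityʳ _)) (cong (2 *_) e)

enumPoly : ℕ → (List Step → Bool) → Poly
enumPoly n c = sumₚ (map (λ p → if c p then schWeight p else 0ₚ) (allSeqs (2 * n)))

Terms-enumPoly : ∀ n c (P : List Step → Bool) →
                 (∀ p → T (c p) → T (schFrom 0 p) × T (P p)) →
                 (∀ p → T (schFrom 0 p) → size p ≡ 2 * n → T (P p) → T (c p)) →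
                 Terms (enumPoly n c) ≅ Fibre (Sub SchröderPaths (λ (p , _) → P p)) n
Terms-enumPoly n c P sound complete =
  Terms-sum-allSeqs (2 * n) _
  ⟫ Σᶜ-cong (λ (p , _) → Terms-if (c p) _ ⟫ ⊗-congˡ (Terms-qpow (numH p)))
  ⟫ record
    { to      = λ ((p , e) , cp , _) → ((p , proj₁ (sound p cp)) , proj₂ (sound p cp)) ,
                                        semilength-of-size n p (proj₁ (sound p cp)) e
    ; from    = λ (((p , v) , Pp) , e) → (p , size-of-semilength n p v e) ,
                                          complete p v (size-of-semilength n p v e) Pp , tt
    ; from-to = λ ((p , _) , _) → cong₂ (λ e cp → (p , e) , cp , tt) (uip _ _) (Boolₚ.T-irrelevant _ _)
    ; to-from = λ (((p , _) , _) , _) → cong₂ (λ (v , Pp) e → ((p , v) , Pp) , e)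
                                          (cong₂ _,_ (Boolₚ.T-irrelevant _ _) (Boolₚ.T-irrelevant _ _)) (uip _ _)
    ; xdeg-to = λ _ → refl
    ; qdeg-to = λ _ → refl }

-- Decompositions of Schröder paths; the weight β

-- 𝕩[1+𝕢] is α = (q + 1) x
[1+𝕢] 𝕩[1+𝕢] : Class
[1+𝕢]  = mkClass Bool (λ _ → 0) (λ b → if b then 1 else 0)
𝕩[1+𝕢] = mkClass Bool (λ _ → 1) (λ b → if b then 1 else 0)

[1+𝕢]⊗ : ∀ {A} → [1+𝕢] ⊗ A ≅ A ⊕ 𝕢 ⊗ A
[1+𝕢]⊗ = record
  { to      = λ { (false , a) → inj₁ a ; (true , a) → inj₂ (tt , a) }
  ; from    = λ { (inj₁ a) → false , a ; (inj₂ (_ , a)) → true , a }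
  ; from-to = λ { (false , _) → refl ; (true , _) → refl }
  ; to-from = λ { (inj₁ _) → refl ; (inj₂ _) → refl }
  ; xdeg-to = λ { (false , _) → refl ; (true , _) → refl }
  ; qdeg-to = λ { (false , _) → refl ; (true , _) → refl } }

Terms-[1+q] : Terms [1+q] ≅ [1+𝕢]
Terms-[1+q] = record
  { to      = λ { (zero , _) → false ; (suc zero , _) → true }
  ; from    = λ { false → zero , Fin.zero ; true → suc zero , Fin.zero }
  ; from-to = λ { (zero , Fin.zero) → refl ; (suc zero , Fin.zero) → refl }
  ; to-from = λ { false → refl ; true → refl }
  ; xdeg-to = λ { (zero , _) → refl ; (suc zero , _) → refl }
  ; qdeg-to = λ { (zero , _) → refl ; (suc zero , _) → refl } }

Fibre-[1+𝕢]⊗ : ∀ {A} n → Fibre ([1+𝕢] ⊗ A) n ≅ [1+𝕢] ⊗ Fibre A n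
Fibre-[1+𝕢]⊗ n = record
  { to      = λ ((b , a) , p) → b , (a , p)
  ; from    = λ (b , (a , p)) → (b , a) , p
  ; from-to = λ _ → refl
  ; to-from = λ _ → refl
  ; xdeg-to = λ _ → refl
  ; qdeg-to = λ _ → refl }

𝒮⁺ : Class
𝒮⁺ = 𝕩𝕢 ⊗ 𝒮 ⊕ 𝕩 ⊗ 𝒮 ⊗ 𝒮

𝒮⁺-positive : Positive 𝒮⁺
𝒮⁺-positive (inj₁ _) = s≤s z≤n
𝒮⁺-positive (inj₂ _) = s≤s z≤n

𝒮-unfold : 𝒮 ≅ 𝟙 ⊕ 𝒮⁺
𝒮-unfold = record
  { to      = λ { leaf → inj₁ tt ; (hstep t) → inj₂ (inj₁ (tt , t)) ; (arch a b) → inj₂ (inj₂ (tt , a , b)) }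
  ; from    = λ { (inj₁ _) → leaf ; (inj₂ (inj₁ (_ , t))) → hstep t ; (inj₂ (inj₂ (_ , a , b))) → arch a b }
  ; from-to = λ { leaf → refl ; (hstep _) → refl ; (arch _ _) → refl }
  ; to-from = λ { (inj₁ _) → refl ; (inj₂ (inj₁ _)) → refl ; (inj₂ (inj₂ _)) → refl }
  ; xdeg-to = λ { leaf → refl ; (hstep _) → refl ; (arch _ _) → refl }
  ; qdeg-to = λ { leaf → refl ; (hstep _) → refl ; (arch _ _) → refl } }

𝒮≅Seq : 𝒮 ≅ Seq (𝕩𝕢 ⊕ 𝕩 ⊗ 𝒮)
𝒮≅Seq = record
  { to = toSeq ; from = fromSeq ; from-to = from-to′ ; to-from = to-from′ ; xdeg-to = xdeg-to′ ; qdeg-to = qdeg-to′ }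
  where
  toSeq : STree → Obj (Seq (𝕩𝕢 ⊕ 𝕩 ⊗ 𝒮))
  toSeq leaf       = []
  toSeq (hstep t)  = inj₁ tt ∷ toSeq t
  toSeq (arch a b) = inj₂ (tt , a) ∷ toSeq b
  fromSeq : Obj (Seq (𝕩𝕢 ⊕ 𝕩 ⊗ 𝒮)) → STree
  fromSeq []                  = leaf
  fromSeq (inj₁ _ ∷ os)       = hstep (fromSeq os)
  fromSeq (inj₂ (_ , a) ∷ os) = arch a (fromSeq os)
  from-to′ : ∀ t → fromSeq (toSeq t) ≡ t
  from-to′ leaf       = refl
  from-to′ (hstep t)  = cong hstep (from-to′ t)
  from-to′ (arch a b) = cong (arch a) (from-to′ b)
  to-from′ : ∀ os → toSeq (fromSeq os) ≡ os
  to-from′ []                  = refl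
  to-from′ (inj₁ _ ∷ os)       = cong (inj₁ tt ∷_) (to-from′ os)
  to-from′ (inj₂ (_ , a) ∷ os) = cong (inj₂ (tt , a) ∷_) (to-from′ os)
  xdeg-to′ : ∀ t → xdeg (Seq (𝕩𝕢 ⊕ 𝕩 ⊗ 𝒮)) (toSeq t) ≡ nodes t
  xdeg-to′ leaf       = refl
  xdeg-to′ (hstep t)  = cong suc (xdeg-to′ t)
  xdeg-to′ (arch a b) = cong (λ n → suc (nodes a + n)) (xdeg-to′ b)
  qdeg-to′ : ∀ t → qdeg (Seq (𝕩𝕢 ⊕ 𝕩 ⊗ 𝒮)) (toSeq t) ≡ hsteps t
  qdeg-to′ leaf       = refl
  qdeg-to′ (hstep t)  = cong suc (qdeg-to′ t)
  qdeg-to′ (arch a b) = cong (hsteps a +_) (qdeg-to′ b)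

small : STree → Bool
small leaf       = true
small (hstep _)  = false
small (arch _ b) = small b

𝒮ₛ : Class
𝒮ₛ = Sub 𝒮 small

𝒮ₛ⁺ : Class
𝒮ₛ⁺ = (𝕩 ⊗ 𝒮) ⊗ Seq (𝕩 ⊗ 𝒮)

𝒮ₛ⁺-positive : Positive 𝒮ₛ⁺
𝒮ₛ⁺-positive _ = s≤s z≤n

𝒮ₛ≅Seq : 𝒮ₛ ≅ Seq (𝕩 ⊗ 𝒮)
𝒮ₛ≅Seq = record
  { to = toSeq ; from = fromSeq ; from-to = from-to′ ; to-from = to-from′ ; xdeg-to = xdeg-to′ ; qdeg-to = qdeg-to′ }
  where
  toSeq : Obj 𝒮ₛ → Obj (Seq (𝕩 ⊗ 𝒮))
  toSeq (leaf , _)     = []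
  toSeq (arch a b , s) = (tt , a) ∷ toSeq (b , s)
  fromSeq : Obj (Seq (𝕩 ⊗ 𝒮)) → Obj 𝒮ₛ
  fromSeq []             = leaf , tt
  fromSeq ((_ , a) ∷ os) = let (b , s) = fromSeq os in arch a b , s
  from-to′ : ∀ t → fromSeq (toSeq t) ≡ t
  from-to′ (leaf , tt)    = refl
  from-to′ (arch a b , s) = cong (λ (b , s) → arch a b , s) (from-to′ (b , s))
  to-from′ : ∀ os → toSeq (fromSeq os) ≡ os
  to-from′ []             = refl
  to-from′ ((_ , a) ∷ os) = cong ((tt , a) ∷_) (to-from′ os)
  xdeg-to′ : ∀ t → xdeg (Seq (𝕩 ⊗ 𝒮)) (toSeq t) ≡ xdeg 𝒮ₛ t
  xdeg-to′ (leaf , _)     = refl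
  xdeg-to′ (arch a b , s) = cong (λ n → suc (nodes a + n)) (xdeg-to′ (b , s))
  qdeg-to′ : ∀ t → qdeg (Seq (𝕩 ⊗ 𝒮)) (toSeq t) ≡ qdeg 𝒮ₛ t
  qdeg-to′ (leaf , _)     = refl
  qdeg-to′ (arch a b , s) = cong (hsteps a +_) (qdeg-to′ (b , s))

𝒮ₛ-unfold : 𝒮ₛ ≅ 𝟙 ⊕ 𝒮ₛ⁺
𝒮ₛ-unfold = 𝒮ₛ≅Seq ⟫ Seq-unfold

-- the first H on the axis, with the rest of the path, becomes a new first arch
hstep↦arch : Seq (𝕩 ⊗ 𝒮) ⊗ 𝕩𝕢 ⊗ 𝒮 ≅ 𝕢 ⊗ 𝒮ₛ⁺
hstep↦arch = record
  { to      = λ (bs , _ , t) → tt , (tt , t) , bs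
  ; from    = λ (_ , (_ , t) , bs) → bs , tt , t
  ; from-to = λ _ → refl
  ; to-from = λ _ → refl
  ; xdeg-to = λ (bs , _ , t) → arithˣ (xdeg (Seq (𝕩 ⊗ 𝒮)) bs) (nodes t)
  ; qdeg-to = λ (bs , _ , t) → arithᵠ (qdeg (Seq (𝕩 ⊗ 𝒮)) bs) (hsteps t) }
  where
  arithˣ : ∀ a b → 0 + ((1 + b) + a) ≡ a + (1 + b)
  arithˣ = solve-∀
  arithᵠ : ∀ a b → 1 + ((0 + b) + a) ≡ a + (1 + b)
  arithᵠ = solve-∀

𝒮-split : 𝒮 ≅ 𝟙 ⊕ (𝒮ₛ⁺ ⊕ 𝕢 ⊗ 𝒮ₛ⁺)
𝒮-split = begin
  𝒮
    ≅⟨ 𝒮≅Seq ⟩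
  Seq (𝕩𝕢 ⊕ 𝕩 ⊗ 𝒮)
    ≅⟨ Seq-⊕-split ⟩
  Seq (𝕩 ⊗ 𝒮) ⊕ Seq (𝕩 ⊗ 𝒮) ⊗ 𝕩𝕢 ⊗ Seq (𝕩𝕢 ⊕ 𝕩 ⊗ 𝒮)
    ≅⟨ ⊕-cong Seq-unfold (⊗-congˡ {Seq (𝕩 ⊗ 𝒮)} (⊗-congˡ {𝕩𝕢} (≅-sym 𝒮≅Seq))) ⟩
  (𝟙 ⊕ 𝒮ₛ⁺) ⊕ Seq (𝕩 ⊗ 𝒮) ⊗ 𝕩𝕢 ⊗ 𝒮
    ≅⟨ ⊕-cong ≅-refl hstep↦arch ⟩
  (𝟙 ⊕ 𝒮ₛ⁺) ⊕ 𝕢 ⊗ 𝒮ₛ⁺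
    ≅⟨ ⊕-assoc ⟩
  𝟙 ⊕ (𝒮ₛ⁺ ⊕ 𝕢 ⊗ 𝒮ₛ⁺) ∎
  where open ≅-Reasoning

𝒮⁺-split : 𝒮⁺ ≅ [1+𝕢] ⊗ 𝒮ₛ⁺
𝒮⁺-split =
  𝟙⊕-cancel 𝒮⁺-positive (λ { (inj₁ _) → s≤s z≤n ; (inj₂ _) → s≤s z≤n }) (≅-sym 𝒮-unfold ⟫ 𝒮-split)
  ⟫ ≅-sym [1+𝕢]⊗

Terms-Rpoly : ∀ n → Terms (Rpoly n) ≅ Fibre 𝒮 n
Terms-Rpoly n =
  Terms-enumPoly n (isSchroder n) (λ _ → true) (λ p v → proj₁ (∧-split v) , tt)
    (λ p v e _ → ∧-intro v (ℕₚ.≡⇒≡ᵇ _ _ e))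
  ⟫ Fibre-cong n (Sub-true ⟫ SchröderPaths≅𝒮)

Terms-Rpoly⁺ : ∀ k → Terms (Rpoly (suc k)) ≅ Fibre 𝒮⁺ (suc k)
Terms-Rpoly⁺ k = Terms-Rpoly (suc k) ⟫ Fibre-cong (suc k) 𝒮-unfold ⟫ Fibre-𝟙⊕ k

smallFrom : ℕ → List Step → Bool
smallFrom h       []      = true
smallFrom h       (U ∷ p) = smallFrom (suc h) p
smallFrom h       (D ∷ p) = smallFrom (pred h) p
smallFrom zero    (H ∷ p) = false
smallFrom (suc h) (H ∷ p) = smallFrom (suc h) p

smallFrom-flatten : ∀ h t rest → smallFrom (suc h) (flatten t ++ rest) ≡ smallFrom (suc h) rest
smallFrom-flatten h leaf       rest = refl
smallFrom-flatten h (hstep t)  rest = smallFrom-flatten h t rest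
smallFrom-flatten h (arch a b) rest =
  trans (cong (smallFrom (suc (suc h))) (Listₚ.++-assoc (flatten a) (D ∷ flatten b) rest))
        (trans (smallFrom-flatten (suc h) a (D ∷ flatten b ++ rest)) (smallFrom-flatten h b rest))

small-flatten : ∀ t → small t ≡ smallFrom 0 (flatten t)
small-flatten leaf       = refl
small-flatten (hstep t)  = refl
small-flatten (arch a b) = trans (small-flatten b) (sym (smallFrom-flatten 0 a (D ∷ flatten b)))

smallPoly : ℕ → Poly
smallPoly n = enumPoly n (λ p → isSchroder n p ∧ smallFrom 0 p)

Terms-smallPoly : ∀ n → Terms (smallPoly n) ≅ Fibre 𝒮ₛ n
Terms-smallPoly n =
  Terms-enumPoly n _ (smallFrom 0)
    (λ p v → let (s , sm) = ∧-split {isSchroder n p} v in proj₁ (∧-split s) , sm)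
    (λ p v e sm → ∧-intro (∧-intro v (ℕₚ.≡⇒≡ᵇ _ _ e)) sm)
  ⟫ Fibre-cong n (≅-sym (Sub-cong (≅-sym SchröderPaths≅𝒮) small _ small-flatten))

Terms-smallPoly⁺ : ∀ k → Terms (smallPoly (suc k)) ≅ Fibre 𝒮ₛ⁺ (suc k)
Terms-smallPoly⁺ k = Terms-smallPoly (suc k) ⟫ Fibre-cong (suc k) 𝒮ₛ-unfold ⟫ Fibre-𝟙⊕ k

Rpoly≅[1+q]*smallPoly : ∀ k → Terms (Rpoly (suc k)) ≅ Terms ([1+q] *ₚ smallPoly (suc k))
Rpoly≅[1+q]*smallPoly k = begin
  Terms (Rpoly (suc k))                    ≅⟨ Terms-Rpoly⁺ k ⟩
  Fibre 𝒮⁺ (suc k)                         ≅⟨ Fibre-cong (suc k) 𝒮⁺-split ⟩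
  Fibre ([1+𝕢] ⊗ 𝒮ₛ⁺) (suc k)               ≅⟨ Fibre-[1+𝕢]⊗ (suc k) ⟩
  [1+𝕢] ⊗ Fibre 𝒮ₛ⁺ (suc k)                 ≅⟨ ≅-sym (⊗-cong Terms-[1+q] (Terms-smallPoly⁺ k)) ⟩
  Terms [1+q] ⊗ Terms (smallPoly (suc k))  ≅⟨ ≅-sym (Terms-*ₚ [1+q] (smallPoly (suc k))) ⟩
  Terms ([1+q] *ₚ smallPoly (suc k))       ∎
  where open ≅-Reasoning

Terms-βS : ∀ k → Terms (βS (suc k)) ≅ Fibre 𝒮ₛ⁺ (suc k)
Terms-βS k = divOnePlusQ-exact (Rpoly (suc k)) (smallPoly (suc k)) (Rpoly≅[1+q]*smallPoly k) ⟫ Terms-smallPoly⁺ k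

𝕋₂ : Class
𝕋₂ = 𝕩[1+𝕢] ⊗ 𝕩[1+𝕢] ⊗ Seq 𝕩[1+𝕢]

-- the class of ⋃ A_s (see 𝒜≅𝔽): pyramids x (R − 1) and plateaus S α² / (1 − α)
𝔽 : Class
𝔽 = 𝕩 ⊗ 𝒮⁺ ⊕ 𝒮ₛ⁺ ⊗ 𝕋₂

𝔽-positive : Positive 𝔽
𝔽-positive (inj₁ _) = s≤s z≤n
𝔽-positive (inj₂ _) = s≤s z≤n

𝕩𝒮⁺Seq≅𝔽 : 𝕩 ⊗ 𝒮⁺ ⊗ Seq 𝕩[1+𝕢] ≅ 𝔽
𝕩𝒮⁺Seq≅𝔽 = begin
  𝕩 ⊗ 𝒮⁺ ⊗ Seq 𝕩[1+𝕢]
    ≅⟨ ⊗-congˡ {𝕩} (⊗-congˡ {𝒮⁺} Seq-unfold ⟫ ⊗-unfoldˡ-𝟙⊕) ⟩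
  𝕩 ⊗ (𝒮⁺ ⊕ 𝒮⁺ ⊗ 𝕩[1+𝕢] ⊗ Seq 𝕩[1+𝕢])
    ≅⟨ ⊗-distribˡ-⊕ {𝕩} ⟩
  𝕩 ⊗ 𝒮⁺ ⊕ 𝕩 ⊗ 𝒮⁺ ⊗ 𝕩[1+𝕢] ⊗ Seq 𝕩[1+𝕢]
    ≅⟨ ⊕-cong ≅-refl (⊗-congˡ {𝕩} (⊗-congʳ {B = 𝕩[1+𝕢] ⊗ Seq 𝕩[1+𝕢]} 𝒮⁺-split)) ⟩
  𝕩 ⊗ 𝒮⁺ ⊕ 𝕩 ⊗ ([1+𝕢] ⊗ 𝒮ₛ⁺) ⊗ 𝕩[1+𝕢] ⊗ Seq 𝕩[1+𝕢]
    ≅⟨ ⊕-cong ≅-refl regroup ⟩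
  𝕩 ⊗ 𝒮⁺ ⊕ 𝒮ₛ⁺ ⊗ 𝕋₂ ∎
  where
  open ≅-Reasoning
  arithˣ : ∀ s l → 1 + ((0 + s) + (1 + l)) ≡ s + (1 + (1 + l))
  arithˣ = solve-∀
  arithᵠ : ∀ b s d l → 0 + ((b + s) + (d + l)) ≡ s + (b + (d + l))
  arithᵠ = solve-∀
  -- x times a factor 1 + q is one more α-factor (q + 1) x
  regroup : 𝕩 ⊗ ([1+𝕢] ⊗ 𝒮ₛ⁺) ⊗ 𝕩[1+𝕢] ⊗ Seq 𝕩[1+𝕢] ≅ 𝒮ₛ⁺ ⊗ 𝕋₂
  regroup = record
    { to      = λ (_ , (b , s) , c , l) → s , b , c , l
    ; from    = λ (s , b , c , l) → tt , (b , s) , c , l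
    ; from-to = λ _ → refl
    ; to-from = λ _ → refl
    ; xdeg-to = λ (_ , (b , s) , c , l) → sym (arithˣ (xdeg 𝒮ₛ⁺ s) (xdeg (Seq 𝕩[1+𝕢]) l))
    ; qdeg-to = λ (_ , (b , s) , c , l) →
        sym (arithᵠ (qdeg [1+𝕢] b) (qdeg 𝒮ₛ⁺ s) (qdeg 𝕩[1+𝕢] c) (qdeg (Seq 𝕩[1+𝕢]) l)) }

startsWell : STree → Bool
startsWell leaf                = true
startsWell (hstep _)           = false
startsWell (arch leaf _)       = false
startsWell (arch (hstep _) _)  = true
startsWell (arch (arch _ _) _) = true

startsWell-flatten : ∀ t → startsWell t ≡ goodStart (flatten t)
startsWell-flatten leaf                = refl
startsWell-flatten (hstep _)           = refl
startsWell-flatten (arch leaf _)       = refl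
startsWell-flatten (arch (hstep _) _)  = refl
startsWell-flatten (arch (arch _ _) _) = refl

𝒴 : Class
𝒴 = Sub 𝒮 startsWell

𝒴⁺ : Class
𝒴⁺ = 𝕩 ⊗ 𝒮⁺ ⊗ 𝒮

𝒴-unfold : 𝒴 ≅ 𝟙 ⊕ 𝒴⁺
𝒴-unfold = record
  { to = to′ ; from = from′ ; from-to = from-to′ ; to-from = to-from′ ; xdeg-to = xdeg-to′ ; qdeg-to = qdeg-to′ }
  where
  to′ : Obj 𝒴 → Obj (𝟙 ⊕ 𝒴⁺)
  to′ (leaf , _)               = inj₁ tt
  to′ (arch (hstep a) b , _)   = inj₂ (tt , inj₁ (tt , a) , b)
  to′ (arch (arch a a′) b , _) = inj₂ (tt , inj₂ (tt , a , a′) , b)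
  from′ : Obj (𝟙 ⊕ 𝒴⁺) → Obj 𝒴
  from′ (inj₁ _)                           = leaf , tt
  from′ (inj₂ (_ , inj₁ (_ , a) , b))      = arch (hstep a) b , tt
  from′ (inj₂ (_ , inj₂ (_ , a , a′) , b)) = arch (arch a a′) b , tt
  from-to′ : ∀ y → from′ (to′ y) ≡ y
  from-to′ (leaf , _)              = refl
  from-to′ (arch (hstep _) _ , _)  = refl
  from-to′ (arch (arch _ _) _ , _) = refl
  to-from′ : ∀ y → to′ (from′ y) ≡ y
  to-from′ (inj₁ _)                = refl
  to-from′ (inj₂ (_ , inj₁ _ , _)) = refl
  to-from′ (inj₂ (_ , inj₂ _ , _)) = refl
  xdeg-to′ : ∀ y → xdeg (𝟙 ⊕ 𝒴⁺) (to′ y) ≡ xdeg 𝒴 y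
  xdeg-to′ (leaf , _)              = refl
  xdeg-to′ (arch (hstep _) _ , _)  = refl
  xdeg-to′ (arch (arch _ _) _ , _) = refl
  qdeg-to′ : ∀ y → qdeg (𝟙 ⊕ 𝒴⁺) (to′ y) ≡ qdeg 𝒴 y
  qdeg-to′ (leaf , _)              = refl
  qdeg-to′ (arch (hstep _) _ , _)  = refl
  qdeg-to′ (arch (arch _ _) _ , _) = refl

-- Strip the leading steps H and U D, each counted by 𝕩[1+𝕢].
𝒮≅𝒴⊕ : 𝒮 ≅ 𝒴 ⊕ 𝕩[1+𝕢] ⊗ 𝒮
𝒮≅𝒴⊕ = record
  { to = to′ ; from = from′ ; from-to = from-to′ ; to-from = to-from′ ; xdeg-to = xdeg-to′ ; qdeg-to = qdeg-to′ }
  where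
  to′ : STree → Obj (𝒴 ⊕ 𝕩[1+𝕢] ⊗ 𝒮)
  to′ leaf                 = inj₁ (leaf , tt)
  to′ (hstep t)            = inj₂ (true , t)
  to′ (arch leaf b)        = inj₂ (false , b)
  to′ (arch (hstep a) b)   = inj₁ (arch (hstep a) b , tt)
  to′ (arch (arch a a′) b) = inj₁ (arch (arch a a′) b , tt)
  from′ : Obj (𝒴 ⊕ 𝕩[1+𝕢] ⊗ 𝒮) → STree
  from′ (inj₁ (t , _))     = t
  from′ (inj₂ (true , t))  = hstep t
  from′ (inj₂ (false , b)) = arch leaf b
  from-to′ : ∀ t → from′ (to′ t) ≡ t
  from-to′ leaf                = refl
  from-to′ (hstep _)           = refl
  from-to′ (arch leaf _)       = refl
  from-to′ (arch (hstep _) _)  = refl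
  from-to′ (arch (arch _ _) _) = refl
  to-from′ : ∀ s → to′ (from′ s) ≡ s
  to-from′ (inj₁ (leaf , tt))              = refl
  to-from′ (inj₁ (arch (hstep _) _ , tt))  = refl
  to-from′ (inj₁ (arch (arch _ _) _ , tt)) = refl
  to-from′ (inj₂ (true , _))               = refl
  to-from′ (inj₂ (false , _))              = refl
  xdeg-to′ : ∀ t → xdeg (𝒴 ⊕ 𝕩[1+𝕢] ⊗ 𝒮) (to′ t) ≡ nodes t
  xdeg-to′ leaf                = refl
  xdeg-to′ (hstep _)           = refl
  xdeg-to′ (arch leaf _)       = refl
  xdeg-to′ (arch (hstep _) _)  = refl
  xdeg-to′ (arch (arch _ _) _) = refl
  qdeg-to′ : ∀ t → qdeg (𝒴 ⊕ 𝕩[1+𝕢] ⊗ 𝒮) (to′ t) ≡ hsteps t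
  qdeg-to′ leaf                = refl
  qdeg-to′ (hstep _)           = refl
  qdeg-to′ (arch leaf _)       = refl
  qdeg-to′ (arch (hstep _) _)  = refl
  qdeg-to′ (arch (arch _ _) _) = refl

𝒮≅Seq⊗𝒴 : 𝒮 ≅ Seq 𝕩[1+𝕢] ⊗ 𝒴
𝒮≅Seq⊗𝒴 = solve-linear 𝒮≅𝒴⊕ (λ _ → s≤s z≤n)

𝒴≅Seq𝔽 : 𝒴 ≅ Seq 𝔽
𝒴≅Seq𝔽 = solve-linear (𝒴-unfold ⟫ ⊕-cong ≅-refl 𝒴⁺≅𝔽⊗𝒴) 𝔽-positive ⟫ ⊗-identityʳ
  where
  𝒴⁺≅𝔽⊗𝒴 : 𝒴⁺ ≅ 𝔽 ⊗ 𝒴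
  𝒴⁺≅𝔽⊗𝒴 = begin
    𝕩 ⊗ 𝒮⁺ ⊗ 𝒮
      ≅⟨ ⊗-congˡ {𝕩} (⊗-congˡ {𝒮⁺} 𝒮≅Seq⊗𝒴) ⟩
    𝕩 ⊗ 𝒮⁺ ⊗ Seq 𝕩[1+𝕢] ⊗ 𝒴
      ≅⟨ ⊗-congˡ {𝕩} (≅-sym (⊗-assoc {𝒮⁺} {Seq 𝕩[1+𝕢]})) ⟫ ≅-sym (⊗-assoc {𝕩} {𝒮⁺ ⊗ Seq 𝕩[1+𝕢]}) ⟩
    (𝕩 ⊗ 𝒮⁺ ⊗ Seq 𝕩[1+𝕢]) ⊗ 𝒴
      ≅⟨ ⊗-congʳ {B = 𝒴} 𝕩𝒮⁺Seq≅𝔽 ⟩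
    𝔽 ⊗ 𝒴 ∎
    where open ≅-Reasoning

𝒴ₙ : Class
𝒴ₙ = graded YCopy expY

𝒴ₙ≅𝒴 : 𝒴ₙ ≅ 𝒴
𝒴ₙ≅𝒴 = toPaths ⟫ ≅-sym (Sub-cong (≅-sym SchröderPaths≅𝒮) startsWell _ startsWell-flatten)
  where
  GoodPaths : Class
  GoodPaths = Sub SchröderPaths (λ (p , _) → goodStart p)
  toPaths : 𝒴ₙ ≅ GoodPaths
  toPaths = record
    { to      = λ (n , p , y) → let (s , g) = ∧-split {isSchroder n p} y in (p , proj₁ (∧-split s)) , g
    ; from    = λ ((p , v) , g) →
                  semilength p , p , ∧-intro (∧-intro v (ℕₚ.≡⇒≡ᵇ _ _ (size-of-semilength _ p v refl))) g
    ; from-to = λ (n , p , y) → same p (sizeOk n p y) _ y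
    ; to-from = λ ((p , _) , _) → cong₂ (λ v g → (p , v) , g) (Boolₚ.T-irrelevant _ _) (Boolₚ.T-irrelevant _ _)
    ; xdeg-to = λ (n , p , y) → sizeOk n p y
    ; qdeg-to = λ _ → refl }
    where
    sizeOk : ∀ n p → T (isY n p) → semilength p ≡ n
    sizeOk n p y = let (s , _) = ∧-split {isSchroder n p} y ; (v , e) = ∧-split {schFrom 0 p} s in
                   semilength-of-size n p v (ℕₚ.≡ᵇ⇒≡ _ _ e)
    same : ∀ {n n′} p → n′ ≡ n → (y′ : T (isY n′ p)) (y : T (isY n p)) →
           _≡_ {A = Obj 𝒴ₙ} (n′ , p , y′) (n , p , y)
    same p refl y′ y = cong (λ y → _ , p , y) (Boolₚ.T-irrelevant y′ y)

-- Dyck paths and their primitive factors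

-- Exit h c: from height h, the path c goes below the axis for the first time with its last step.
data Exit : ℕ → List DStep → Set where
  exit : Exit 0 (d ∷ [])
  up   : ∀ {h c} → Exit (suc h) c → Exit h (u ∷ c)
  down : ∀ {h c} → Exit h c → Exit (suc h) (d ∷ c)

data Primitive : List DStep → Set where
  rise : ∀ {c} → Exit 0 c → Primitive (u ∷ c)

reverse-∷-++ : ∀ (s : DStep) pre c → reverse (s ∷ pre) ++ c ≡ reverse pre ++ s ∷ c
reverse-∷-++ s pre c = trans (cong (_++ c) (Listₚ.unfold-reverse s pre)) (Listₚ.++-assoc (reverse pre) [ s ] c)

compsGo-exit : ∀ h pre c rest → Exit h c → compsGo (suc h) pre (c ++ rest) ≡ (reverse pre ++ c) ∷ comps rest
compsGo-exit _       pre _       rest exit     = cong (_∷ comps rest) (Listₚ.unfold-reverse d pre)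
compsGo-exit h       pre (u ∷ c) rest (up e)   =
  trans (compsGo-exit (suc h) (u ∷ pre) c rest e) (cong (_∷ comps rest) (reverse-∷-++ u pre c))
compsGo-exit (suc h) pre (d ∷ c) rest (down e) =
  trans (compsGo-exit h (d ∷ pre) c rest e) (cong (_∷ comps rest) (reverse-∷-++ d pre c))

comps-primitive : ∀ {c} rest → Primitive c → comps (c ++ rest) ≡ c ∷ comps rest
comps-primitive {u ∷ c} rest (rise e) = compsGo-exit 0 (u ∷ []) c rest e

comps-concat : ∀ {cs} → All Primitive cs → comps (concat cs) ≡ cs
comps-concat []                = refl
comps-concat {c ∷ cs} (p ∷ ps) = trans (comps-primitive (concat cs) p) (cong (c ∷_) (comps-concat ps))

mutual
  concat-comps : ∀ p → T (isDyck p) → concat (comps p) ≡ p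
  concat-comps []      _ = refl
  concat-comps (u ∷ p) v = concat-compsGo 0 (u ∷ []) p v

  concat-compsGo : ∀ h pre p → T (dyckFrom (suc h) p) → concat (compsGo (suc h) pre p) ≡ reverse pre ++ p
  concat-compsGo h       pre (u ∷ p) v =
    trans (concat-compsGo (suc h) (u ∷ pre) p v) (reverse-∷-++ u pre p)
  concat-compsGo zero    pre (d ∷ p) v =
    trans (cong (reverse (d ∷ pre) ++_) (concat-comps p v)) (reverse-∷-++ d pre p)
  concat-compsGo (suc h) pre (d ∷ p) v =
    trans (concat-compsGo h (d ∷ pre) p v) (reverse-∷-++ d pre p)

dyckFrom-exit : ∀ {h c} m rest → Exit h c → T (dyckFrom m rest) → T (dyckFrom (suc (h + m)) (c ++ rest))
dyckFrom-exit m rest exit     v = v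
dyckFrom-exit m rest (up e)   v = dyckFrom-exit m rest e v
dyckFrom-exit m rest (down e) v = dyckFrom-exit m rest e v

isDyck-primitive-++ : ∀ {c} rest → Primitive c → T (isDyck rest) → T (isDyck (c ++ rest))
isDyck-primitive-++ rest (rise e) = dyckFrom-exit 0 rest e

isDyck-concat : ∀ {cs} → All Primitive cs → T (isDyck (concat cs))
isDyck-concat []       = tt
isDyck-concat (p ∷ ps) = isDyck-primitive-++ _ p (isDyck-concat ps)

upSteps : List DStep → ℕ
upSteps []      = 0
upSteps (u ∷ p) = suc (upSteps p)
upSteps (d ∷ p) = upSteps p

upSteps-++ : ∀ a b → upSteps (a ++ b) ≡ upSteps a + upSteps b
upSteps-++ []      b = refl
upSteps-++ (u ∷ a) b = cong suc (upSteps-++ a b)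
upSteps-++ (d ∷ a) b = upSteps-++ a b

upSteps-primitive : ∀ {c} → Primitive c → 0 < upSteps c
upSteps-primitive (rise _) = s≤s z≤n

dyckFrom-u : ∀ h p → dyckFrom h (u ∷ p) ≡ dyckFrom (suc h) p
dyckFrom-u zero    p = refl
dyckFrom-u (suc h) p = refl

length≡2*upSteps : ∀ h p → T (dyckFrom h p) → length p ≡ 2 * upSteps p + h
length≡2*upSteps zero    []      _ = refl
length≡2*upSteps h       (u ∷ p) v =
  trans (cong suc (length≡2*upSteps (suc h) p (subst T (dyckFrom-u h p) v))) (arith (upSteps p) h)
  where
  arith : ∀ a h → suc (2 * a + suc h) ≡ 2 * suc a + h
  arith = solve-∀
length≡2*upSteps (suc h) (d ∷ p) v = trans (cong suc (length≡2*upSteps h p v)) (sym (ℕₚ.+-suc _ h))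

fromRuns : List (DStep × ℕ) → List DStep
fromRuns []            = []
fromRuns ((s , k) ∷ r) = replicate k s ++ fromRuns r

fromPairs : List (ℕ × ℕ) → List DStep
fromPairs []             = []
fromPairs ((a , b) ∷ ps) = replicate a u ++ replicate b d ++ fromPairs ps

consRun : DStep → List (DStep × ℕ) → List (DStep × ℕ)
consRun s []             = (s , 1) ∷ []
consRun s ((t , k) ∷ rs) = if sameStep s t then (t , suc k) ∷ rs else (s , 1) ∷ (t , k) ∷ rs

runs-∷ : ∀ s p → runs (s ∷ p) ≡ consRun s (runs p)
runs-∷ s p with runs p
... | []    = refl
... | _ ∷ _ = refl

sameStep-≡ : ∀ s t → T (sameStep s t) → s ≡ t
sameStep-≡ u u _ = refl
sameStep-≡ d d _ = refl

fromRuns-consRun : ∀ s rs → fromRuns (consRun s rs) ≡ s ∷ fromRuns rs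
fromRuns-consRun s []             = refl
fromRuns-consRun s ((t , k) ∷ rs) with sameStep s t in eq
... | true with refl ← sameStep-≡ s t (subst T (sym eq) tt) = refl
... | false = refl

fromRuns-runs : ∀ p → fromRuns (runs p) ≡ p
fromRuns-runs []      = refl
fromRuns-runs (s ∷ p) =
  trans (cong fromRuns (runs-∷ s p)) (trans (fromRuns-consRun s (runs p)) (cong (s ∷_) (fromRuns-runs p)))

fromRuns-toPairs : ∀ rs {ps} → toPairs rs ≡ just ps → fromRuns rs ≡ fromPairs ps
fromRuns-toPairs []                           refl = refl
fromRuns-toPairs ((u , a) ∷ (d , b) ∷ rs) eq with toPairs rs in eq′
fromRuns-toPairs ((u , a) ∷ (d , b) ∷ rs) refl | just _ =
  cong (λ p → replicate a u ++ replicate b d ++ p) (fromRuns-toPairs rs eq′)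

toPairs-runs-sound : ∀ p {ps} → toPairs (runs p) ≡ just ps → p ≡ fromPairs ps
toPairs-runs-sound p eq = trans (sym (fromRuns-runs p)) (fromRuns-toPairs (runs p) eq)

pairRuns : List (ℕ × ℕ) → List (DStep × ℕ)
pairRuns []             = []
pairRuns ((a , b) ∷ ps) = (u , a) ∷ (d , b) ∷ pairRuns ps

PositivePairs : List (ℕ × ℕ) → Set
PositivePairs = All (λ (a , b) → 0 < a × 0 < b)

private
  NotHeadedBy : DStep → List (DStep × ℕ) → Set
  NotHeadedBy s []            = ⊤
  NotHeadedBy s ((t , _) ∷ _) = sameStep s t ≡ false

  sameStep-refl : ∀ s → sameStep s s ≡ true
  sameStep-refl u = refl
  sameStep-refl d = refl

  runs-replicate : ∀ a s rest → NotHeadedBy s (runs rest) → runs (replicate (suc a) s ++ rest) ≡ (s , suc a) ∷ runs rest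
  runs-replicate zero s rest h with runs rest
  ... | []           = refl
  ... | (t , k) ∷ rs rewrite h = refl
  runs-replicate (suc a) s rest h
    rewrite runs-∷ s (replicate (suc a) s ++ rest) | runs-replicate a s rest h | sameStep-refl s = refl

  notHeadedBy-d : ∀ ps → NotHeadedBy d (pairRuns ps)
  notHeadedBy-d []      = tt
  notHeadedBy-d (_ ∷ _) = refl

runs-fromPairs : ∀ {ps} → PositivePairs ps → runs (fromPairs ps) ≡ pairRuns ps
runs-fromPairs [] = refl
runs-fromPairs {(suc a , suc b) ∷ ps} ((s≤s _ , s≤s _) ∷ pos) =
  trans (runs-replicate a u _ (subst (NotHeadedBy u) (sym ds) refl)) (cong ((u , suc a) ∷_) ds)
  where
  ds : runs (replicate (suc b) d ++ fromPairs ps) ≡ (d , suc b) ∷ pairRuns ps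
  ds = trans (runs-replicate b d _ (subst (NotHeadedBy d) (sym (runs-fromPairs pos)) (notHeadedBy-d ps)))
             (cong ((d , suc b) ∷_) (runs-fromPairs pos))

toPairs-pairRuns : ∀ ps → toPairs (pairRuns ps) ≡ just ps
toPairs-pairRuns []                                         = refl
toPairs-pairRuns ((a , b) ∷ ps) rewrite toPairs-pairRuns ps = refl

toPairs-runs-fromPairs : ∀ {ps} → PositivePairs ps → toPairs (runs (fromPairs ps)) ≡ just ps
toPairs-runs-fromPairs {ps} pos = trans (cong toPairs (runs-fromPairs pos)) (toPairs-pairRuns ps)

-- since α = (q + 1) x, all inner pyramids have height 1
Shape : Set
Shape = ℕ ⊎ (ℕ × ℕ)

-- u ^ (m + 2) d ^ (m + 2), weighted by γ_(m+2) = R_(m+1)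
pattern pyramid m   = inj₁ m
-- u ^ (k + 1) (u d) ^ (r + 2) d ^ (k + 1), weighted by β_(k+1) α_1 ^ (r + 2)
pattern plateau k r = inj₂ (k , r)

plateauTail : ℕ → ℕ → List (ℕ × ℕ)
plateauTail k r = replicate r (1 , 1) ++ (1 , suc (suc k)) ∷ []

shapePairs : Shape → List (ℕ × ℕ)
shapePairs (pyramid m)   = (suc (suc m) , suc (suc m)) ∷ []
shapePairs (plateau k r) = (suc (suc k) , 1) ∷ plateauTail k r

shapePath : Shape → List DStep
shapePath σ = fromPairs (shapePairs σ)

α₁s : List (ℕ × ℕ) → Poly
α₁s ps = prodₚ (map (λ (a , _) → αS a) ps)

shapeWeight : Shape → Poly
shapeWeight (pyramid m)   = Rpoly (suc m)
shapeWeight (plateau k r) = βS (suc k) *ₚ ([1+q] *ₚ α₁s (plateauTail k r))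

shapeSize : Shape → ℕ
shapeSize (pyramid m)   = suc (suc m)
shapeSize (plateau k r) = suc k + suc (suc r)

shapePairs-positive : ∀ σ → PositivePairs (shapePairs σ)
shapePairs-positive (pyramid m)   = (s≤s z≤n , s≤s z≤n) ∷ []
shapePairs-positive (plateau k r) = (s≤s z≤n , s≤s z≤n) ∷ tail r
  where
  tail : ∀ r → PositivePairs (plateauTail k r)
  tail zero    = (s≤s z≤n , s≤s z≤n) ∷ []
  tail (suc r) = (s≤s z≤n , s≤s z≤n) ∷ tail r

exit-ups : ∀ a h c → Exit (h + a) c → Exit h (replicate a u ++ c)
exit-ups zero    h c e = subst (λ k → Exit k c) (ℕₚ.+-identityʳ h) e
exit-ups (suc a) h c e = up (exit-ups a (suc h) c (subst (λ k → Exit k c) (ℕₚ.+-suc h a) e))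

exit-downs : ∀ h → Exit h (replicate (suc h) d ++ [])
exit-downs zero    = exit
exit-downs (suc h) = down (exit-downs h)

exit-plateauTail : ∀ k r → Exit k (fromPairs (plateauTail k r))
exit-plateauTail k zero    = up (exit-downs (suc k))
exit-plateauTail k (suc r) = up (down (exit-plateauTail k r))

shapePath-primitive : ∀ σ → Primitive (shapePath σ)
shapePath-primitive (pyramid m)   = rise (exit-ups (suc m) 0 _ (exit-downs (suc m)))
shapePath-primitive (plateau k r) = rise (exit-ups (suc k) 0 _ (down (exit-plateauTail k r)))

isPrimitive-shapePath : ∀ σ → isPrimitive (shapePath σ) ≡ true
isPrimitive-shapePath σ = Equivalence.to Boolₚ.T-≡ (∧-intro dyck (ℕₚ.≡⇒≡ᵇ _ _ (cong length one)))
  where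
  c = shapePath σ
  dyck : T (isDyck c)
  dyck = subst (λ p → T (isDyck p)) (Listₚ.++-identityʳ c) (isDyck-primitive-++ [] (shapePath-primitive σ) tt)
  one : comps c ≡ c ∷ []
  one = trans (cong comps (sym (Listₚ.++-identityʳ c))) (comps-primitive [] (shapePath-primitive σ))

≡ᵇ-refl : ∀ n → (n ≡ᵇ n) ≡ true
≡ᵇ-refl zero    = refl
≡ᵇ-refl (suc n) = ≡ᵇ-refl n

valleys-ups : ∀ a h c → valleys h (replicate a u ++ c) ≡ valleys (h + a) c
valleys-ups zero    h c = cong (λ k → valleys k c) (sym (ℕₚ.+-identityʳ h))
valleys-ups (suc a) h c = trans (valleys-ups a (suc h) c) (cong (λ k → valleys k c) (sym (ℕₚ.+-suc h a)))

valleys-downs : ∀ b h → valleys h (replicate b d ++ []) ≡ []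
valleys-downs zero          h = refl
valleys-downs (suc zero)    h = refl
valleys-downs (suc (suc b)) h = valleys-downs (suc b) (h ∸ 1)

valleys-plateauTail : ∀ k r → valleys (suc k) (fromPairs (plateauTail k r)) ≡ replicate r (suc k)
valleys-plateauTail k zero          = valleys-downs (suc (suc k)) (suc (suc k))
valleys-plateauTail k (suc zero)    = cong (suc k ∷_) (valleys-plateauTail k zero)
valleys-plateauTail k (suc (suc r)) = cong (suc k ∷_) (valleys-plateauTail k (suc r))

allEqual-replicate : ∀ r x → allEqual (x ∷ replicate r x) ≡ true
allEqual-replicate zero    x                   = refl
allEqual-replicate (suc r) x rewrite ≡ᵇ-refl x = allEqual-replicate r x

valleys-shapePath : ∀ σ → allEqual (valleys 0 (shapePath σ)) ≡ true
valleys-shapePath (pyramid m)   =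
  cong allEqual (trans (valleys-ups (suc (suc m)) 0 _) (valleys-downs (suc (suc m)) (suc (suc m))))
valleys-shapePath (plateau k r) =
  trans (cong allEqual (trans (valleys-ups (suc (suc k)) 0 _) (valleys-d∷ r))) (allEqual-replicate r (suc k))
  where
  valleys-d∷ : ∀ r → valleys (suc (suc k)) (d ∷ fromPairs (plateauTail k r)) ≡ suc k ∷ replicate r (suc k)
  valleys-d∷ zero    = cong (suc k ∷_) (valleys-plateauTail k zero)
  valleys-d∷ (suc r) = cong (suc k ∷_) (valleys-plateauTail k (suc r))

tailOK-plateauTail : ∀ k r → tailOK (plateauTail k r) (suc k) ≡ true
tailOK-plateauTail k zero          = ≡ᵇ-refl (suc (suc k))
tailOK-plateauTail k (suc zero)    = tailOK-plateauTail k zero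
tailOK-plateauTail k (suc (suc r)) = tailOK-plateauTail k (suc r)

formWeight-shapePairs : ∀ σ → formWeight (shapePairs σ) ≡ shapeWeight σ
formWeight-shapePairs (pyramid m)         rewrite ≡ᵇ-refl m                      = refl
formWeight-shapePairs (plateau k zero)    rewrite tailOK-plateauTail k zero    = refl
formWeight-shapePairs (plateau k (suc r)) rewrite tailOK-plateauTail k (suc r) = refl

wA-shapePath : ∀ σ → wA (shapePath σ) ≡ shapeWeight σ
wA-shapePath σ
  rewrite isPrimitive-shapePath σ | valleys-shapePath σ | toPairs-runs-fromPairs (shapePairs-positive σ)
  = formWeight-shapePairs σ

upSteps-fromPairs : ∀ a b ps → upSteps (fromPairs ((a , b) ∷ ps)) ≡ a + upSteps (fromPairs ps)
upSteps-fromPairs a b ps =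
  trans (upSteps-++ (replicate a u) _) (cong₂ _+_ (ups a) (trans (upSteps-++ (replicate b d) _) (cong (_+ _) (downs b))))
  where
  ups : ∀ a → upSteps (replicate a u) ≡ a
  ups zero    = refl
  ups (suc a) = cong suc (ups a)
  downs : ∀ b → upSteps (replicate b d) ≡ 0
  downs zero    = refl
  downs (suc b) = downs b

upSteps-shapePath : ∀ σ → upSteps (shapePath σ) ≡ shapeSize σ
upSteps-shapePath (pyramid m)   = trans (upSteps-fromPairs _ _ []) (ℕₚ.+-identityʳ _)
upSteps-shapePath (plateau k r) =
  trans (upSteps-fromPairs _ _ (plateauTail k r)) (trans (cong (suc (suc k) +_) (tail r)) (sym (ℕₚ.+-suc (suc k) (suc r))))
  where
  tail : ∀ r → upSteps (fromPairs (plateauTail k r)) ≡ suc r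
  tail zero    = upSteps-fromPairs 1 (suc (suc k)) []
  tail (suc r) = trans (upSteps-fromPairs 1 1 (plateauTail k r)) (cong suc (tail r))

noTerms : Obj (Terms []) → ⊥
noTerms (_ , ())

αS-support : ∀ a → Obj (Terms (αS a)) → a ≡ 1
αS-support (suc zero) _ = refl

γS-support : ∀ a → Obj (Terms (γS a)) → ∃ λ m → a ≡ suc (suc m)
γS-support (suc (suc m)) _ = m , refl

plateauTail-of : ∀ rs k → T (tailOK rs (suc k)) → Obj (Terms (α₁s rs)) → ∃ λ r → rs ≡ plateauTail k r
plateauTail-of ((a , b) ∷ []) k ok x
  with refl ← αS-support a (proj₁ (to (Terms-*ₚ (αS a) 1ₚ) x))
  with refl ← ℕₚ.≡ᵇ⇒≡ b (suc (suc k)) ok = 0 , refl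
plateauTail-of ((a , b) ∷ rs@(_ ∷ _)) k ok x =
  let xα , xs = to (Terms-*ₚ (αS a) (α₁s rs)) x
      a≡b , ok′ = ∧-split {a ≡ᵇ b} ok
      r , rs≡ = plateauTail-of rs k ok′ xs
  in suc r , cong₂ _∷_ (peak (αS-support a xα) (ℕₚ.≡ᵇ⇒≡ a b a≡b)) rs≡
  where
  peak : ∀ {a b} → a ≡ 1 → a ≡ b → (a , b) ≡ (1 , 1)
  peak refl refl = refl

shapeOf-formWeight : ∀ ps → Obj (Terms (formWeight ps)) → ∃ λ σ → shapePairs σ ≡ ps
shapeOf-formWeight ((a , b) ∷ []) x with a ≡ᵇ b in eq
... | false = ⊥-elim (noTerms x)
... | true with refl ← ℕₚ.≡ᵇ⇒≡ a b (subst T (sym eq) tt) with m , refl ← γS-support a x = pyramid m , refl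
shapeOf-formWeight ((a , b) ∷ rs@(_ ∷ _)) x with (b <ᵇ a) ∧ tailOK rs (a ∸ b) in eq
... | false = ⊥-elim (noTerms x)
... | true
  with 1<a , ok ← ∧-split {b <ᵇ a} (subst T (sym eq) tt)
  with xβ , xαs ← to (Terms-*ₚ (βS (a ∸ b)) (αS b *ₚ α₁s rs)) x
  with refl ← αS-support b (proj₁ (to (Terms-*ₚ (αS b) (α₁s rs)) xαs))
  with s≤s (s≤s _) ← ℕₚ.<ᵇ⇒< 1 a 1<a
  with r , rs≡ ← plateauTail-of rs _ ok (proj₂ (to (Terms-*ₚ [1+q] (α₁s rs)) xαs))
  = plateau _ r , cong (_ ∷_) (sym rs≡)

shapeOf : ∀ c → Obj (Terms (wA c)) → ∃ λ σ → shapePath σ ≡ c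
shapeOf c = shapeOf-if (isPrimitive c ∧ allEqual (valleys 0 c))
  where
  shapeOf-if : ∀ b → Obj (Terms (if b then maybe formWeight 0ₚ (toPairs (runs c)) else 0ₚ)) → ∃ λ σ → shapePath σ ≡ c
  shapeOf-if false x = ⊥-elim (noTerms x)
  shapeOf-if true  x with toPairs (runs c) in eq
  ... | nothing = ⊥-elim (noTerms x)
  ... | just ps with σ , refl ← shapeOf-formWeight ps x = σ , sym (toPairs-runs-sound c eq)

shapePairs-injective : ∀ σ σ′ → shapePairs σ ≡ shapePairs σ′ → σ ≡ σ′
shapePairs-injective (pyramid m)       (pyramid .m)       refl = refl
shapePairs-injective (plateau k r)     (plateau k′ r′)    eq
  with refl , eq′ ← Listₚ.∷-injective eq
  = cong (plateau k) (ℕₚ.suc-injective (trans (sym (len r)) (trans (cong length eq′) (len r′))))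
  where
  len : ∀ r → length (plateauTail k r) ≡ suc r
  len zero    = refl
  len (suc r) = cong suc (len r)
shapePairs-injective (pyramid _)       (plateau _ zero)    ()
shapePairs-injective (pyramid _)       (plateau _ (suc _)) ()
shapePairs-injective (plateau _ zero)    (pyramid _)       ()
shapePairs-injective (plateau _ (suc _)) (pyramid _)       ()

shapePath-injective : ∀ {σ σ′} → shapePath σ ≡ shapePath σ′ → σ ≡ σ′
shapePath-injective {σ} {σ′} eq = shapePairs-injective σ σ′ (just-injective (begin
  just (shapePairs σ)              ≡⟨ sym (toPairs-runs-fromPairs (shapePairs-positive σ)) ⟩
  toPairs (runs (shapePath σ))     ≡⟨ cong (λ p → toPairs (runs p)) eq ⟩
  toPairs (runs (shapePath σ′))    ≡⟨ toPairs-runs-fromPairs (shapePairs-positive σ′) ⟩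
  just (shapePairs σ′)             ∎))
  where
  open ≡-Reasoning

𝒜 : Class
𝒜 = Σᶜ (List DStep) (λ c → atX (upSteps c) (Terms (wA c)))

Shapes : Class
Shapes = Σᶜ Shape (λ σ → atX (shapeSize σ) (Terms (shapeWeight σ)))

𝒜≅Shapes : 𝒜 ≅ Shapes
𝒜≅Shapes = ≅-sym (Σᶜ-cong (λ σ → ≡⇒≅ (cong₂ atX (sym (upSteps-shapePath σ)) (cong Terms (sym (wA-shapePath σ)))))
                   ⟫ Σᶜ-support shapePath shapePath-injective _ shapeOf)

primitive-of : ∀ c → Obj (Terms (wA c)) → Primitive c
primitive-of c x = let (σ , eq) = shapeOf c x in subst Primitive eq (shapePath-primitive σ)

𝒜-positive : Positive 𝒜
𝒜-positive (c , x) = upSteps-primitive (primitive-of c x)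

Fibre-Seq𝕩[1+𝕢]-0 : Fibre (Seq 𝕩[1+𝕢]) 0 ≅ 𝟙
Fibre-Seq𝕩[1+𝕢]-0 = record
  { to = λ _ → tt ; from = λ _ → [] , refl
  ; from-to = λ { ([] , refl) → refl } ; to-from = λ _ → refl
  ; xdeg-to = λ _ → refl ; qdeg-to = λ { ([] , refl) → refl } }

Fibre-Seq𝕩[1+𝕢]-suc : ∀ n → [1+𝕢] ⊗ Fibre (Seq 𝕩[1+𝕢]) n ≅ Fibre (Seq 𝕩[1+𝕢]) (suc n)
Fibre-Seq𝕩[1+𝕢]-suc n = record
  { to      = λ (b , bs , p) → (b ∷ bs) , cong suc p
  ; from    = λ { ((b ∷ bs) , p) → b , bs , ℕₚ.suc-injective p }
  ; from-to = λ (b , bs , _) → cong (λ p → b , bs , p) (uip _ _)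
  ; to-from = λ { ((b ∷ bs) , _) → cong ((b ∷ bs) ,_) (uip _ _) }
  ; xdeg-to = λ _ → refl
  ; qdeg-to = λ _ → refl }

Terms-α₁s : ∀ k r → Terms (α₁s (plateauTail k r)) ≅ Fibre (Seq 𝕩[1+𝕢]) (suc r)
Terms-α₁s k zero =
  Terms-*ₚ [1+q] 1ₚ ⟫ ⊗-cong Terms-[1+q] (Terms-1ₚ ⟫ ≅-sym Fibre-Seq𝕩[1+𝕢]-0) ⟫ Fibre-Seq𝕩[1+𝕢]-suc 0
Terms-α₁s k (suc r) =
  Terms-*ₚ [1+q] (α₁s (plateauTail k r)) ⟫ ⊗-cong Terms-[1+q] (Terms-α₁s k r) ⟫ Fibre-Seq𝕩[1+𝕢]-suc (suc r)

Σᶜ-atX-[1+𝕢]⊗ : ∀ (f : ℕ → ℕ) (X : ℕ → Class) →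
                Σᶜ ℕ (λ m → atX (suc (f m)) ([1+𝕢] ⊗ X m)) ≅ 𝕩[1+𝕢] ⊗ Σᶜ ℕ (λ m → atX (f m) (X m))
Σᶜ-atX-[1+𝕢]⊗ f X = record
  { to = λ (m , b , x) → b , m , x ; from = λ (b , m , x) → m , b , x
  ; from-to = λ _ → refl ; to-from = λ _ → refl ; xdeg-to = λ _ → refl ; qdeg-to = λ _ → refl }

Seq𝕩[1+𝕢]-length≥1 : Σᶜ ℕ (λ r → atX (suc r) (Fibre (Seq 𝕩[1+𝕢]) (suc r))) ≅ 𝕩[1+𝕢] ⊗ Seq 𝕩[1+𝕢]
Seq𝕩[1+𝕢]-length≥1 =
  Σᶜ-cong (λ r → atX-cong (suc r) (≅-sym (Fibre-Seq𝕩[1+𝕢]-suc r)))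
  ⟫ Σᶜ-atX-[1+𝕢]⊗ (λ r → r) (Fibre (Seq 𝕩[1+𝕢]))
  ⟫ ⊗-congˡ {𝕩[1+𝕢]} (Σᶜ-Fibre (Seq 𝕩[1+𝕢]))

Seq𝕩[1+𝕢]-length≥2 : Σᶜ ℕ (λ r → atX (suc (suc r)) ([1+𝕢] ⊗ Fibre (Seq 𝕩[1+𝕢]) (suc r))) ≅ 𝕋₂
Seq𝕩[1+𝕢]-length≥2 =
  Σᶜ-atX-[1+𝕢]⊗ suc (λ r → Fibre (Seq 𝕩[1+𝕢]) (suc r)) ⟫ ⊗-congˡ {𝕩[1+𝕢]} Seq𝕩[1+𝕢]-length≥1

pyramids≅𝕩𝒮⁺ : Σᶜ ℕ (λ m → atX (suc (suc m)) (Terms (Rpoly (suc m)))) ≅ 𝕩 ⊗ 𝒮⁺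
pyramids≅𝕩𝒮⁺ =
  Σᶜ-cong (λ m → atX-cong (suc (suc m)) (Terms-Rpoly⁺ m))
  ⟫ Σᶜ-atX-suc suc (λ m → Fibre 𝒮⁺ (suc m))
  ⟫ ⊗-congˡ {𝕩} (Σᶜ-Fibre⁺ 𝒮⁺ 𝒮⁺-positive)

plateaus≅𝒮ₛ⁺𝕋₂ : Σᶜ (ℕ × ℕ) (λ (k , r) → atX (suc k + suc (suc r)) (Terms (shapeWeight (plateau k r)))) ≅
                 𝒮ₛ⁺ ⊗ 𝕋₂
plateaus≅𝒮ₛ⁺𝕋₂ =
  Σᶜ-cong (λ (k , r) → atX-cong _
    (Terms-*ₚ (βS (suc k)) ([1+q] *ₚ α₁s (plateauTail k r))
     ⟫ ⊗-cong (Terms-βS k) (Terms-*ₚ [1+q] (α₁s (plateauTail k r)) ⟫ ⊗-cong Terms-[1+q] (Terms-α₁s k r))))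
  ⟫ Σᶜ-atX-⊗ suc (λ r → suc (suc r)) (λ k → Fibre 𝒮ₛ⁺ (suc k)) (λ r → [1+𝕢] ⊗ Fibre (Seq 𝕩[1+𝕢]) (suc r))
  ⟫ ⊗-cong (Σᶜ-Fibre⁺ 𝒮ₛ⁺ 𝒮ₛ⁺-positive) Seq𝕩[1+𝕢]-length≥2

𝒜≅𝔽 : 𝒜 ≅ 𝔽
𝒜≅𝔽 = 𝒜≅Shapes ⟫ Σᶜ-⊎ _ ⟫ ⊕-cong pyramids≅𝕩𝒮⁺ plateaus≅𝒮ₛ⁺𝕋₂

Factors : Class
Factors = Σᶜ (List (List DStep)) (λ cs → atX (sum (map upSteps cs)) (Terms (prodₚ (map wA cs))))

private
  factor : ∀ c cs → Obj (Terms (prodₚ (map wA (c ∷ cs)))) → Obj (Terms (wA c)) × Obj (Terms (prodₚ (map wA cs)))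
  factor c cs = to (Terms-*ₚ (wA c) (prodₚ (map wA cs)))

Factors-unfold : Factors ≅ 𝟙 ⊕ 𝒜 ⊗ Factors
Factors-unfold = record
  { to      = λ { ([] , _) → inj₁ tt ; (c ∷ cs , t) → let (x , xs) = factor c cs t in inj₂ ((c , x) , (cs , xs)) }
  ; from    = λ { (inj₁ _) → [] , from Terms-1ₚ tt
                ; (inj₂ ((c , x) , (cs , xs))) → c ∷ cs , from (Terms-*ₚ (wA c) _) (x , xs) }
  ; from-to = λ { ([] , t) → cong ([] ,_) (from-to Terms-1ₚ t)
                ; (c ∷ cs , t) → cong (c ∷ cs ,_) (from-to (Terms-*ₚ (wA c) _) t) }
  ; to-from = λ { (inj₁ _) → refl
                ; (inj₂ ((c , x) , (cs , xs))) →
                    cong (λ (x , xs) → inj₂ ((c , x) , (cs , xs))) (to-from (Terms-*ₚ (wA c) _) (x , xs)) }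
  ; xdeg-to = λ { ([] , _) → refl ; (_ ∷ _ , _) → refl }
  ; qdeg-to = λ { ([] , t) → qdeg-to Terms-1ₚ t ; (c ∷ cs , t) → qdeg-to (Terms-*ₚ (wA c) _) t } }

allPrimitive : ∀ cs → Obj (Terms (prodₚ (map wA cs))) → All Primitive cs
allPrimitive []       _ = []
allPrimitive (c ∷ cs) t = let (x , xs) = factor c cs t in primitive-of c x ∷ allPrimitive cs xs

allInA : ∀ cs → Obj (Terms (prodₚ (map wA cs))) → T (allB inA cs)
allInA []       _ = tt
allInA (c ∷ cs) t =
  let (x , xs) = factor c cs t in ∧-intro (subst (λ b → T (not b)) (sym (Terms-nonzero (wA c) x)) tt) (allInA cs xs)

upSteps-concat : ∀ cs → upSteps (concat cs) ≡ sum (map upSteps cs)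
upSteps-concat []       = refl
upSteps-concat (c ∷ cs) = trans (upSteps-++ c (concat cs)) (cong (upSteps c +_) (upSteps-concat cs))

isV-concat : ∀ cs → Obj (Terms (prodₚ (map wA cs))) → T (isV (sum (map upSteps cs)) (concat cs))
isV-concat cs t =
  ∧-intro dyck (∧-intro (ℕₚ.≡⇒≡ᵇ _ _ len) (subst (λ cs → T (allB inA cs)) (sym (comps-concat prims)) (allInA cs t)))
  where
  prims = allPrimitive cs t
  dyck  = isDyck-concat prims
  len : length (concat cs) ≡ 2 * sum (map upSteps cs)
  len = trans (length≡2*upSteps 0 (concat cs) dyck) (trans (ℕₚ.+-identityʳ _) (cong (2 *_) (upSteps-concat cs)))

upSteps-comps : ∀ n p → T (isV n p) → sum (map upSteps (comps p)) ≡ n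
upSteps-comps n p v = begin
  sum (map upSteps (comps p))  ≡⟨ sym (upSteps-concat (comps p)) ⟩
  upSteps (concat (comps p))   ≡⟨ cong upSteps (concat-comps p dyck) ⟩
  upSteps p                    ≡⟨ ℕₚ.*-cancelˡ-≡ (upSteps p) n 2 (trans (sym len) (ℕₚ.≡ᵇ⇒≡ _ _ (proj₁ (∧-split rest)))) ⟩
  n                            ∎
  where
  open ≡-Reasoning
  dyck = proj₁ (∧-split {isDyck p} v)
  rest = proj₂ (∧-split {isDyck p} v)
  len : length p ≡ 2 * upSteps p
  len = trans (length≡2*upSteps 0 p dyck) (ℕₚ.+-identityʳ _)

𝒱 : Class
𝒱 = graded VCopy expV

𝒱≅Factors : 𝒱 ≅ Factors
𝒱≅Factors = record
  { to      = λ (_ , p , _ , t) → comps p , t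
  ; from    = λ (cs , t) → sum (map upSteps cs) , concat cs , isV-concat cs t , subst (λ p → Obj (Terms p)) (wV-concat cs t) t
  ; from-to = λ (n , p , v , t) → glued (upSteps-comps n p v) (concat-comps p (proj₁ (∧-split {isDyck p} v)))
                                         (isV-concat (comps p) t) v (wV-concat (comps p) t) t
  ; to-from = λ (cs , t) → split (comps-concat (allPrimitive cs t)) t
  ; xdeg-to = λ (n , p , v , _) → upSteps-comps n p v
  ; qdeg-to = λ _ → refl }
  where
  wV-concat : ∀ cs → Obj (Terms (prodₚ (map wA cs))) → prodₚ (map wA cs) ≡ wV (concat cs)
  wV-concat cs t = cong (λ cs → prodₚ (map wA cs)) (sym (comps-concat (allPrimitive cs t)))
  glued : ∀ {n n′ p p′} → n′ ≡ n → p′ ≡ p → ∀ v′ v (e : wV p ≡ wV p′) t →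
          _≡_ {A = Obj 𝒱} (n′ , p′ , v′ , subst (λ p → Obj (Terms p)) e t) (n , p , v , t)
  glued refl refl v′ v e t rewrite uip e refl | Boolₚ.T-irrelevant v′ v = refl
  split : ∀ {cs′ cs} (e : cs′ ≡ cs) t →
          _≡_ {A = Obj Factors} (cs′ , subst (λ p → Obj (Terms p)) (cong (λ cs → prodₚ (map wA cs)) (sym e)) t) (cs , t)
  split refl t = refl

𝒱≅Seq𝔽 : 𝒱 ≅ Seq 𝔽
𝒱≅Seq𝔽 = 𝒱≅Factors ⟫ solve-linear Factors-unfold 𝒜-positive ⟫ ⊗-identityʳ ⟫ Seq-cong 𝒜≅𝔽

corollary3p4 : (n : ℕ) →
    Σ (YCopy n ⤖ VCopy n) (λ b → (c : YCopy n) → expY n c ≡ expV n (Bijection.to b c))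
corollary3p4 n = toBijection (begin
  mkClass (YCopy n) (λ _ → 0) (expY n)  ≅⟨ ≅-sym (Fibre-graded YCopy expY n) ⟩
  Fibre 𝒴ₙ n                            ≅⟨ Fibre-cong n (𝒴ₙ≅𝒴 ⟫ 𝒴≅Seq𝔽 ⟫ ≅-sym 𝒱≅Seq𝔽) ⟩
  Fibre 𝒱 n                             ≅⟨ Fibre-graded VCopy expV n ⟩
  mkClass (VCopy n) (λ _ → 0) (expV n)  ∎)
  where open ≅-Reasoning
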